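{- Let $n,k,t,\ell$ be integers with $k-t\geq\ell\geq 0$, and let $\mathcal{F}=\mathcal{F}_\ell^t(n,k)$. (i) If $\mathcal{F}$ and $\mathcal{B}\subset\binom{[n]}{k}$ are cross $t$-intersecting and $|\mathcal{F}|=|\mathcal{B}|$, then $\mathcal{F}=\mathcal{B}$. (ii) Let $n\geq 2k-t+2$ and $t\geq 2$. If $\mathcal{A}$ and $\mathcal{B}$ are cross $t$-intersecting families in $\binom{[n]}{k}$ and $1\le i<j\le n$ are such that $s_{ij}(\mathcal{A})=s_{ij}(\mathcal{B})=\mathcal{F}$, then $\mathcal{A}=\mathcal{B}\cong\mathcal{F}$.
   Context: $\mathcal{F}_\ell^t(n,k)=\{F\in\binom{[n]}{k}:|F\cap[t+2\ell]|\geq t+\ell\}$. Families are cross $t$-intersecting if $|A\cap B|\ge t$ for all $A\in\mathcal{A},B\in\mathcal{B}$. For $1\le i<j\le n$ and a family $\mathcal{G}$ of subsets of $[n]$, the shifting $s_{ij}(\mathcal{G})=\{s_{ij}(G):G\in\mathcal{G}\}$, where $s_{ij}(G)=(G\setminus\{j\})\cup\{i\}$ if $G\cap\{i,j\}=\{j\}$ and $(G\setminus\{j\})\cup\{i\}\notin\mathcal{G}$, and $s_{ij}(G)=G$ otherwise. $\cong$ means isomorphic via a permutation of $[n]$ applied to all members.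
   Formalization: Part (i) holds only for t ≥ 1 and n ≥ 2k−t+1; these hypotheses stand over the whole lemma but follow from t ≥ 2 and n ≥ 2k−t+2 in part (ii). Apart from conventions, each condition added here is assumed in the paper as well or is needed for the statement above to hold. -}

module Defs where

open import Data.Nat using (ℕ; zero; suc; _+_; _*_; _≤_; _<ᵇ_; _≤ᵇ_; _≡ᵇ_)
open import Data.Bool using (Bool; true; false; _∧_; not; if_then_else_)
open import Data.Fin using (Fin; toℕ)
open import Data.Fin.Subset using (Subset; inside; outside; _∩_; ∣_∣)
open import Data.Fin.Permutation using (Permutation′; _⟨$⟩ˡ_)
open import Data.Vec using (Vec; []; _∷_; lookup; tabulate; _[_]≔_)
open import Data.List using (List; []; _∷_; map; _++_)
open import Data.Nat.ListAction using (sum)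
open import Data.Product using (Σ; _×_; ∃)
open import Relation.Binary.PropositionalEquality using (_≡_)

Family : ℕ → Set
Family n = Subset n → Bool

_∈ᶠ_ : ∀ {n} → Subset n → Family n → Set
S ∈ᶠ 𝒜 = 𝒜 S ≡ true

IsKUniform : ∀ {n} → ℕ → Family n → Set
IsKUniform k 𝒜 = ∀ S → S ∈ᶠ 𝒜 → ∣ S ∣ ≡ k

_≐_ : ∀ {n} → Family n → Family n → Set
𝒜 ≐ ℬ = ∀ S → 𝒜 S ≡ ℬ S

allSubsets : (n : ℕ) → List (Subset n)
allSubsets zero = [] ∷ []
allSubsets (suc n) = map (inside ∷_) (allSubsets n) ++ map (outside ∷_) (allSubsets n)

card : ∀ {n} → Family n → ℕ
card {n} 𝒜 = sum (map (λ S → if 𝒜 S then 1 else 0) (allSubsets n))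

-- the initial segment [m] ∩ [n] = {x : toℕ x < m}  (elements are 0-indexed)
initSeg : (n m : ℕ) → Subset n
initSeg n m = tabulate (λ x → toℕ x <ᵇ m)

-- F_ℓ^t(n,k) = {F ∈ ([n] choose k) : |F ∩ [t+2ℓ]| ≥ t+ℓ}
Fam : (n k t ℓ : ℕ) → Family n
Fam n k t ℓ S = (∣ S ∣ ≡ᵇ k) ∧ ((t + ℓ) ≤ᵇ ∣ S ∩ initSeg n (t + 2 * ℓ) ∣)

CrossInt : ∀ {n} → ℕ → Family n → Family n → Set
CrossInt t 𝒜 ℬ = ∀ A B → A ∈ᶠ 𝒜 → B ∈ᶠ ℬ → t ≤ ∣ A ∩ B ∣

swapIn : ∀ {n} → Fin n → Fin n → Subset n → Subset n
swapIn i j G = (G [ j ]≔ outside) [ i ]≔ inside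

shiftSet : ∀ {n} → Fin n → Fin n → Family n → Subset n → Subset n
shiftSet i j 𝒢 G =
  if lookup G j ∧ not (lookup G i) ∧ not (𝒢 (swapIn i j G))
  then swapIn i j G else G

_∈shift[_,_]_ : ∀ {n} → Subset n → Fin n → Fin n → Family n → Set
S ∈shift[ i , j ] 𝒢 = ∃ λ G → G ∈ᶠ 𝒢 × shiftSet i j 𝒢 G ≡ S

ShiftEq : ∀ {n} → Fin n → Fin n → Family n → Family n → Set
ShiftEq i j 𝒢 ℱ = ∀ S → (S ∈shift[ i , j ] 𝒢 → S ∈ᶠ ℱ) × (S ∈ᶠ ℱ → S ∈shift[ i , j ] 𝒢)

permSet : ∀ {n} → Permutation′ n → Subset n → Subset n
permSet σ S = tabulate (λ y → lookup S (σ ⟨$⟩ˡ y))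

_≅ᶠ_ : ∀ {n} → Family n → Family n → Set
_≅ᶠ_ {n} 𝒜 ℱ = Σ (Permutation′ n) λ σ → ∀ S → 𝒜 S ≡ ℱ (permSet σ S)

-- Call G ∈ ℱ critical if i ∈ G, j ∉ G and G − i + j ∉ ℱ. A family 𝒳 with s_ij(𝒳) = ℱ contains exactly
-- one of G and G − i + j for each critical G, every other member of ℱ, and nothing else, so it is
-- determined by the critical sets it contains. For F = F_ℓ^t(n,k) and M = [t+2ℓ] the critical sets are
-- the k-sets containing i, missing j and meeting M in exactly t+ℓ points. Cross t-intersection makes 𝒜
-- contain G iff ℬ contains K whenever G, K are critical with |G ∩ K| ≤ t, because G − i + j meets K in
-- one point fewer than G. Critical sets differing by one exchange have a common critical K meeting both
-- in t points (M minus ℓ of their common points, plus k − t − ℓ points outside M ∪ G ∪ H, which needs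
-- n ≥ 2k − t + 2), and such exchanges connect all critical sets; so 𝒜 and ℬ contain all critical sets or
-- none, i.e. 𝒜 = ℬ is F or its image under the transposition (i j). For (i), a k-set B ∉ F meets in
-- fewer than t points the member of F made of t + ℓ points of M and k − t − ℓ further points, each chosen
-- to avoid B as far as possible; hence a cross t-intersecting ℬ with |ℬ| = |F| lies in F and equals it.

module Submission where

open import Defs
open import Data.Nat using (ℕ; _+_; _*_; _≤_)
open import Data.Fin using (Fin)
open import Data.Fin renaming (_<_ to _<ᶠ_) using ()
open import Data.Product using (_×_)
open import Relation.Binary.PropositionalEquality using (_≡_)

open import Data.Nat using (zero; suc; _<_; z≤n; s≤s; s≤s⁻¹; _<ᵇ_; _≤ᵇ_; _≡ᵇ_; _≤?_; _<?_)
open import Data.Nat.Properties hiding (_≟_)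
open import Data.Nat.ListAction using (sum)
open import Data.Nat.Tactic.RingSolver using (solve-∀)
open import Data.Bool using (Bool; true; false; _∧_; _∨_; not; if_then_else_)
open import Data.Bool.Properties
  using ( ∧-comm; ∧-zeroʳ; ∧-identityʳ; ∨-zeroʳ; ∨-identityʳ; ∧-conicalˡ; ∧-conicalʳ
        ; not-involutive; not-¬; ¬-not; ⇔→≡; T-≡)
  renaming (_≟_ to _≟ᵇ_)
open import Data.Fin using (zero; suc; toℕ; _≟_)
open import Data.Fin.Subset as Subset using (Subset; inside; outside)
open import Data.Fin.Subset.Properties using (anySubset?)
open import Data.Fin.Permutation using (transpose; id)
import Data.Fin.Permutation.Components as PC
open import Data.Vec as Vec using (Vec; lookup; tabulate)
open import Data.Vec.Properties
  using (lookup-zipWith; lookup∘tabulate; tabulate∘lookup; tabulate-cong; lookup∘update; lookup∘update′)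
import Data.Vec.Functional as Vector
open import Data.List using (List; []; _∷_; map)
import Data.List.Membership.Propositional as List
open import Data.List.Membership.Propositional.Properties using (∈-map⁺; ∈-++⁺ˡ; ∈-++⁺ʳ)
open import Data.List.Relation.Unary.Any using (here; there)
open import Data.Product using (Σ-syntax; ∃; _,_; proj₁; proj₂)
open import Data.Sum using (_⊎_; inj₁; inj₂)
open import Data.Empty using (⊥; ⊥-elim)
open import Function using (_∘_; mk⇔; Equivalence)
open import Relation.Nullary using (Dec; does; yes; no; ¬_; _×-dec_)
open import Relation.Nullary.Decidable using (dec-true)
open import Relation.Binary.PropositionalEquality

private variable
  n : ℕ

-- Characteristic functions rather than Subset n, so that Boolean combinations of sets compute pointwise.
Sub : ℕ → Set
Sub n = Fin n → Bool

infix  4 _∈_ _∉_ _⊆_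
infixl 7 _∩_ _∖_
infixl 6 _∪_

_∈_ _∉_ : Fin n → Sub n → Set
x ∈ f = f x ≡ true
x ∉ f = f x ≡ false

_⊆_ : Sub n → Sub n → Set
f ⊆ g = ∀ x → x ∈ f → x ∈ g

Disjoint : Sub n → Sub n → Set
Disjoint f g = ∀ x → x ∈ f → x ∉ g

_∩_ _∪_ _∖_ : Sub n → Sub n → Sub n
(f ∩ g) x = f x ∧ g x
(f ∪ g) x = f x ∨ g x
(f ∖ g) x = f x ∧ not (g x)

∁ : Sub n → Sub n
∁ f x = not (f x)

⁅_⁆ : Fin n → Sub n
⁅ a ⁆ x = does (x ≟ a)

true-or-false : ∀ b → b ≡ true ⊎ b ≡ false
true-or-false true  = inj₁ refl
true-or-false false = inj₂ refl

two-points : ∀ (f : Sub n) a b → f a ≡ f b ⊎ (a ∈ f × b ∉ f) ⊎ (a ∉ f × b ∈ f)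
two-points f a b with f a | f b
... | true  | true  = inj₁ refl
... | false | false = inj₁ refl
... | true  | false = inj₂ (inj₁ (refl , refl))
... | false | true  = inj₂ (inj₂ (refl , refl))

∈∩⁻ : ∀ (f g : Sub n) x → x ∈ f ∩ g → x ∈ f × x ∈ g
∈∩⁻ f g x x∈f∩g = ∧-conicalˡ (f x) (g x) x∈f∩g , ∧-conicalʳ (f x) (g x) x∈f∩g

∈∁⁻ : ∀ (f : Sub n) x → x ∈ ∁ f → x ∉ f
∈∁⁻ f x x∈∁f = trans (sym (not-involutive (f x))) (cong not x∈∁f)

∈∖⁻ : ∀ (f g : Sub n) x → x ∈ f ∖ g → x ∈ f × x ∉ g
∈∖⁻ f g x x∈f∖g with ∈∩⁻ f (∁ g) x x∈f∖g
... | x∈f , x∈∁g = x∈f , ∈∁⁻ g x x∈∁g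

∈∖⁅⁆⁻ : ∀ (f : Sub n) a x → x ∈ f ∖ ⁅ a ⁆ → x ∈ f × ¬ x ≡ a
∈∖⁅⁆⁻ f a x x∈f∖a with ∈∖⁻ f ⁅ a ⁆ x x∈f∖a
... | x∈f , x∉a = x∈f , λ { refl → not-¬ x∉a (dec-true (a ≟ a) refl) }

∈∪⁅⁆⁻ : ∀ (f : Sub n) a x → x ∈ f ∪ ⁅ a ⁆ → ¬ x ≡ a → x ∈ f
∈∪⁅⁆⁻ f a x x∈f∪a x≢a with f x | x ≟ a
... | true  | _        = refl
... | false | yes x≡a  with () ← x≢a x≡a

∈∉⇒≢ : ∀ (f : Sub n) {a b} → a ∈ f → b ∉ f → ¬ a ≡ b
∈∉⇒≢ f a∈f b∉f refl with () ← trans (sym a∈f) b∉f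

⊆⇒⊆∪ : ∀ {f g : Sub n} h → f ⊆ g → f ⊆ g ∪ h
⊆⇒⊆∪ h f⊆g x x∈f = cong (_∨ h x) (f⊆g x x∈f)

-- Written with if_then_else_ so that card 𝒜 is literally the sum of ⟦ 𝒜 S ⟧ over all S.
⟦_⟧ : Bool → ℕ
⟦ b ⟧ = if b then 1 else 0

⟦⟧-mono : ∀ {p q} → (p ≡ true → q ≡ true) → ⟦ p ⟧ ≤ ⟦ q ⟧
⟦⟧-mono {false} _   = z≤n
⟦⟧-mono {true}  p⇒q rewrite p⇒q refl = ≤-refl

⟦⟧-injective : ∀ {p q} → ⟦ p ⟧ ≡ ⟦ q ⟧ → p ≡ q
⟦⟧-injective {true}  {true}  _ = refl
⟦⟧-injective {false} {false} _ = refl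

-- Counting

# : Sub n → ℕ
# {zero}  f = 0
# {suc n} f = ⟦ f zero ⟧ + # (f ∘ suc)

#-cong : {f g : Sub n} → f ≗ g → # f ≡ # g
#-cong {zero}  f≗g = refl
#-cong {suc n} f≗g = cong₂ _+_ (cong ⟦_⟧ (f≗g zero)) (#-cong (f≗g ∘ suc))

#-empty : {f : Sub n} → (∀ x → x ∉ f) → # f ≡ 0
#-empty {zero}  _ = refl
#-empty {suc n} {f} f-empty rewrite f-empty zero = #-empty (f-empty ∘ suc)

#-full : {f : Sub n} → (∀ x → x ∈ f) → # f ≡ n
#-full {zero}  _ = refl
#-full {suc n} {f} f-full rewrite f-full zero = cong suc (#-full (f-full ∘ suc))

#≡0⇒∉ : {f : Sub n} → # f ≡ 0 → ∀ x → x ∉ f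
#≡0⇒∉ {suc n} {f} #f≡0 x with f zero in f₀
#≡0⇒∉ {suc n} {f} #f≡0 zero    | false = f₀
#≡0⇒∉ {suc n} {f} #f≡0 (suc x) | false = #≡0⇒∉ #f≡0 x

#-nonempty : {f : Sub n} → 0 < # f → ∃ λ x → x ∈ f
#-nonempty {suc n} {f} 0<#f with f zero in f₀
... | true  = zero , f₀
... | false with #-nonempty {f = f ∘ suc} 0<#f
... | x , x∈f = suc x , x∈f

#-split : ∀ (f g : Sub n) → # f ≡ # (f ∩ g) + # (f ∖ g)
#-split {zero}  f g = refl
#-split {suc n} f g with f zero | g zero | #-split (f ∘ suc) (g ∘ suc)
... | true  | true  | ih = cong suc ih
... | true  | false | ih = trans (cong suc ih) (sym (+-suc _ _))
... | false | _     | ih = ih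

#-∩-comm : ∀ (f g : Sub n) → # (f ∩ g) ≡ # (g ∩ f)
#-∩-comm f g = #-cong (λ x → ∧-comm (f x) (g x))

#-∪ : {f g : Sub n} → Disjoint f g → # (f ∪ g) ≡ # f + # g
#-∪ {zero}  _ = refl
#-∪ {suc n} {f} {g} f∩g≡∅ with f zero | g zero | f∩g≡∅ zero | #-∪ {f = f ∘ suc} {g ∘ suc} (f∩g≡∅ ∘ suc)
... | true  | true  | f₀∉g | _  with () ← f₀∉g refl
... | true  | false | _    | ih = cong suc ih
... | false | true  | _    | ih = trans (cong suc ih) (sym (+-suc _ _))
... | false | false | _    | ih = ih

#-mono : {f g : Sub n} → f ⊆ g → # f ≤ # g
#-mono {zero}  _ = z≤n
#-mono {suc n} {f} {g} f⊆g with f zero | g zero | f⊆g zero | #-mono {f = f ∘ suc} {g ∘ suc} (f⊆g ∘ suc)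
... | true  | true  | _    | ih = s≤s ih
... | true  | false | f₀⊆g | _  with () ← f₀⊆g refl
... | false | true  | _    | ih = m≤n⇒m≤1+n ih
... | false | false | _    | ih = ih

#∖≡0⇒⊆ : ∀ {f g : Sub n} → # (f ∖ g) ≡ 0 → f ⊆ g
#∖≡0⇒⊆ {f = f} {g} #f∖g≡0 x x∈f with true-or-false (g x)
... | inj₁ x∈g = x∈g
... | inj₂ x∉g with #≡0⇒∉ {f = f ∖ g} #f∖g≡0 x
...   | x∉f∖g rewrite x∈f | x∉g with () ← x∉f∖g

#-∩⁅⁆ : ∀ (f : Sub n) a → # (f ∩ ⁅ a ⁆) ≡ ⟦ f a ⟧
#-∩⁅⁆ f zero    = begin
  ⟦ f zero ∧ true ⟧ + # (λ x → f (suc x) ∧ false) ≡⟨ cong₂ _+_ (cong ⟦_⟧ (∧-identityʳ (f zero)))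
                                                              (#-empty (λ x → ∧-zeroʳ (f (suc x)))) ⟩
  ⟦ f zero ⟧ + 0                                  ≡⟨ +-identityʳ _ ⟩
  ⟦ f zero ⟧                                      ∎
  where open ≡-Reasoning
#-∩⁅⁆ f (suc a) =
  trans (cong (_+ # (f ∘ suc ∩ ⁅ a ⁆)) (cong ⟦_⟧ (∧-zeroʳ (f zero)))) (#-∩⁅⁆ (f ∘ suc) a)

#-point : ∀ (f : Sub n) a → # f ≡ ⟦ f a ⟧ + # (f ∖ ⁅ a ⁆)
#-point f a = trans (#-split f ⁅ a ⁆) (cong (_+ # (f ∖ ⁅ a ⁆)) (#-∩⁅⁆ f a))

#-≤-∖⁅⁆ : ∀ (f : Sub n) a → # f ≤ suc (# (f ∖ ⁅ a ⁆))
#-≤-∖⁅⁆ f a = subst (_≤ suc (# (f ∖ ⁅ a ⁆))) (sym (#-point f a)) (+-monoˡ-≤ _ (⟦⟧≤1 (f a)))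
  where
  ⟦⟧≤1 : ∀ p → ⟦ p ⟧ ≤ 1
  ⟦⟧≤1 true  = ≤-refl
  ⟦⟧≤1 false = z≤n

#-∁ : ∀ (f : Sub n) → # f + # (∁ f) ≡ n
#-∁ f = trans (sym (#-split (λ _ → true) f)) (#-full (λ _ → refl))

⊆⇒∩-≗ : {f g : Sub n} → g ⊆ f → f ∩ g ≗ g
⊆⇒∩-≗ {f = f} {g} g⊆f x with g x in g₀
... | true  = trans (cong (_∧ true) (g⊆f x g₀)) refl
... | false = ∧-zeroʳ (f x)

#-∖-⊆ : {f g : Sub n} → g ⊆ f → # (f ∖ g) + # g ≡ # f
#-∖-⊆ {f = f} {g} g⊆f = begin
  # (f ∖ g) + # g       ≡⟨ +-comm _ (# g) ⟩
  # g + # (f ∖ g)       ≡⟨ cong (_+ # (f ∖ g)) (#-cong (⊆⇒∩-≗ g⊆f)) ⟨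
  # (f ∩ g) + # (f ∖ g) ≡⟨ #-split f g ⟨
  # f                   ∎
  where open ≡-Reasoning

#-∖-comm : {f g : Sub n} → # f ≡ # g → # (f ∖ g) ≡ # (g ∖ f)
#-∖-comm {f = f} {g} #f≡#g = +-cancelˡ-≡ (# (f ∩ g)) _ _ (begin
  # (f ∩ g) + # (f ∖ g) ≡⟨ #-split f g ⟨
  # f                   ≡⟨ #f≡#g ⟩
  # g                   ≡⟨ #-split g f ⟩
  # (g ∩ f) + # (g ∖ f) ≡⟨ cong (_+ # (g ∖ f)) (#-cong (λ x → ∧-comm (g x) (f x))) ⟩
  # (f ∩ g) + # (g ∖ f) ∎)
  where open ≡-Reasoning

#-∩-carve : ∀ {X M D W : Sub n} → D ⊆ X ∩ M → Disjoint X W →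
  # (X ∩ (M ∖ D ∪ W)) + # D ≡ # (X ∩ M)
#-∩-carve {X = X} {M} {D} {W} D⊆X∩M X∩W≡∅ = trans (cong (_+ # D) (#-cong carved)) (#-∖-⊆ D⊆X∩M)
  where
  carved : X ∩ (M ∖ D ∪ W) ≗ X ∩ M ∖ D
  carved x with X x in x∈?X
  ... | false = refl
  ... | true  rewrite X∩W≡∅ x x∈?X = ∨-identityʳ _

exchange-partner : ∀ {f g X : Sub n} → # (f ∩ X) ≡ # (g ∩ X) → 0 < # (f ∖ g ∩ X) →
  ∃ λ b → b ∈ g ∖ f ∩ X
exchange-partner {f = f} {g} {X} #f∩X≡#g∩X 0<#f∖g∩X = #-nonempty (begin-strict
  0                   <⟨ 0<#f∖g∩X ⟩
  # (f ∖ g ∩ X)       ≡⟨ #-cong (regroup f g) ⟩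
  # (f ∩ X ∖ (g ∩ X)) ≡⟨ #-∖-comm {f = f ∩ X} {g ∩ X} #f∩X≡#g∩X ⟩
  # (g ∩ X ∖ (f ∩ X)) ≡⟨ #-cong (regroup g f) ⟨
  # (g ∖ f ∩ X)       ∎)
  where
  open ≤-Reasoning
  regroup : ∀ f g → f ∖ g ∩ X ≗ f ∩ X ∖ (g ∩ X)
  regroup f g x with f x | g x | X x
  ... | true  | true  | true  = refl
  ... | true  | true  | false = refl
  ... | true  | false | true  = refl
  ... | true  | false | false = refl
  ... | false | _     | _     = refl

pick : ∀ (f : Sub n) c → c ≤ # f → Σ[ g ∈ Sub n ] g ⊆ f × # g ≡ c
pick {zero}  f zero    _ = f , (λ _ x∈f → x∈f) , refl
pick {suc n} f zero    _ = (λ _ → false) , (λ _ ()) , #-empty {suc n} (λ _ → refl)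
pick {suc n} f (suc c) c<#f with f zero in f₀
... | true  with pick (f ∘ suc) c (s≤s⁻¹ c<#f)
...   | g , g⊆f , #g≡c = (true Vector.∷ g) , (λ { zero _ → f₀ ; (suc x) → g⊆f x }) , cong suc #g≡c
pick {suc n} f (suc c) c<#f | false with pick (f ∘ suc) (suc c) c<#f
...   | g , g⊆f , #g≡c = (false Vector.∷ g) , (λ { zero () ; (suc x) → g⊆f x }) , #g≡c

pick-avoiding : ∀ (f X : Sub n) c → c ≤ # f →
  Σ[ g ∈ Sub n ] g ⊆ f × # g ≡ c × (Disjoint g X ⊎ f ∖ X ⊆ g)
pick-avoiding f X c c≤#f with c ≤? # (f ∖ X)
... | yes c≤ with pick (f ∖ X) c c≤
...   | g , g⊆f∖X , #g≡c = g , g⊆f , #g≡c , inj₁ g∩X≡∅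
  where
  g⊆f : g ⊆ f
  g⊆f x x∈g with f x | X x | g⊆f∖X x x∈g
  ... | true | false | _ = refl
  g∩X≡∅ : Disjoint g X
  g∩X≡∅ x x∈g with f x | X x | g⊆f∖X x x∈g
  ... | true | false | _ = refl
pick-avoiding f X c c≤#f | no c≰ with m≤n⇒∃[o]m+o≡n (≰⇒≥ c≰)
... | d , #f∖X+d≡c with pick (f ∩ X) d d≤#f∩X
  where
  d≤#f∩X : d ≤ # (f ∩ X)
  d≤#f∩X = +-cancelˡ-≤ (# (f ∖ X)) d (# (f ∩ X)) (begin
    # (f ∖ X) + d         ≡⟨ #f∖X+d≡c ⟩
    c                     ≤⟨ c≤#f ⟩
    # f                   ≡⟨ #-split f X ⟩
    # (f ∩ X) + # (f ∖ X) ≡⟨ +-comm (# (f ∩ X)) (# (f ∖ X)) ⟩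
    # (f ∖ X) + # (f ∩ X) ∎)
    where open ≤-Reasoning
...   | h , h⊆f∩X , #h≡d = f ∖ X ∪ h , g⊆f , #g≡c , inj₂ (λ x x∈f∖X → cong (_∨ h x) x∈f∖X)
  where
  g⊆f : f ∖ X ∪ h ⊆ f
  g⊆f x x∈g with f x | X x | h x | h⊆f∩X x
  ... | true  | _    | _    | _     = refl
  ... | false | _    | true | h⊆   = h⊆ refl
  disjoint : Disjoint (f ∖ X) h
  disjoint x x∈f∖X with f x | X x | h x in h₀ | h⊆f∩X x
  ... | true | false | false | _   = refl
  ... | true | false | true  | h⊆ with () ← h⊆ refl
  #g≡c : # (f ∖ X ∪ h) ≡ c
  #g≡c = trans (#-∪ disjoint) (trans (cong (# (f ∖ X) +_) #h≡d) #f∖X+d≡c)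

∈-exchange : ∀ (f : Sub n) a b → b ∈ f ∖ ⁅ a ⁆ ∪ ⁅ b ⁆
∈-exchange f a b with b ≟ b
... | yes _   = ∨-zeroʳ _
... | no b≢b  with () ← b≢b refl

∉-exchange : ∀ (f : Sub n) {a b} → ¬ a ≡ b → a ∉ f ∖ ⁅ a ⁆ ∪ ⁅ b ⁆
∉-exchange f {a} {b} a≢b with a ≟ a | a ≟ b
... | yes _   | no _     = trans (∨-identityʳ _) (∧-zeroʳ (f a))
... | yes _   | yes a≡b  with () ← a≢b a≡b
... | no a≢a  | _        with () ← a≢a refl

exchange-other : ∀ (f : Sub n) {a b x} → ¬ x ≡ a → ¬ x ≡ b → (f ∖ ⁅ a ⁆ ∪ ⁅ b ⁆) x ≡ f x
exchange-other f {a} {b} {x} x≢a x≢b with x ≟ a | x ≟ b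
... | no _      | no _      = trans (∨-identityʳ _) (∧-identityʳ (f x))
... | yes x≡a   | _         with () ← x≢a x≡a
... | no _      | yes x≡b   with () ← x≢b x≡b

#-exchange : ∀ (f : Sub n) {a b} → a ∈ f → b ∉ f → ∀ X →
  # ((f ∖ ⁅ a ⁆ ∪ ⁅ b ⁆) ∩ X) + ⟦ X a ⟧ ≡ # (f ∩ X) + ⟦ X b ⟧
#-exchange f {a} {b} a∈f b∉f X = begin
  # g + ⟦ X a ⟧                        ≡⟨ cong (_+ ⟦ X a ⟧) (#-point g b) ⟩
  ⟦ g b ⟧ + # (g ∖ ⁅ b ⁆) + ⟦ X a ⟧     ≡⟨ cong₂ (λ u v → ⟦ u ⟧ + v + ⟦ X a ⟧) gb≡Xb (#-cong rest) ⟩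
  ⟦ X b ⟧ + R + ⟦ X a ⟧                 ≡⟨ swap-ends ⟦ X b ⟧ R ⟦ X a ⟧ ⟩
  ⟦ X a ⟧ + R + ⟦ X b ⟧                 ≡⟨ cong (λ u → ⟦ u ⟧ + R + ⟦ X b ⟧) (cong (_∧ X a) a∈f) ⟨
  ⟦ (f ∩ X) a ⟧ + R + ⟦ X b ⟧           ≡⟨ cong (_+ ⟦ X b ⟧) (#-point (f ∩ X) a) ⟨
  # (f ∩ X) + ⟦ X b ⟧                  ∎
  where
  open ≡-Reasoning
  g = (f ∖ ⁅ a ⁆ ∪ ⁅ b ⁆) ∩ X
  R = # (f ∩ X ∖ ⁅ a ⁆)
  swap-ends : ∀ p q r → p + q + r ≡ r + q + p
  swap-ends p q r = trans (+-comm (p + q) r) (trans (cong (r +_) (+-comm p q)) (sym (+-assoc r q p)))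
  gb≡Xb : g b ≡ X b
  gb≡Xb rewrite b∉f | dec-true (b ≟ b) refl = refl
  rest : g ∖ ⁅ b ⁆ ≗ f ∩ X ∖ ⁅ a ⁆
  rest x with x ≟ b | x ≟ a
  ... | yes refl | _        rewrite b∉f = ∧-zeroʳ (X x)
  ... | no _     | yes refl rewrite a∈f = sym (∧-zeroʳ (X x))
  ... | no _     | no _     with f x
  ...   | true  = refl
  ...   | false = refl

#-exchange-size : ∀ (f : Sub n) {a b} → a ∈ f → b ∉ f → # (f ∖ ⁅ a ⁆ ∪ ⁅ b ⁆) ≡ # f
#-exchange-size f {a} {b} a∈f b∉f = +-cancelʳ-≡ 1 _ _ (begin
  # f′ + 1          ≡⟨ cong (_+ 1) (#-cong (λ x → ∧-identityʳ (f′ x))) ⟨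
  # (f′ ∩ all) + 1  ≡⟨ #-exchange f a∈f b∉f all ⟩
  # (f ∩ all) + 1   ≡⟨ cong (_+ 1) (#-cong (λ x → ∧-identityʳ (f x))) ⟩
  # f + 1           ∎)
  where
  open ≡-Reasoning
  f′ = f ∖ ⁅ a ⁆ ∪ ⁅ b ⁆
  all : Sub n
  all _ = true

#-exchange-∩ : ∀ (f : Sub n) {a b} X → a ∈ f → b ∉ f → a ∈ X → b ∉ X →
  suc (# ((f ∖ ⁅ a ⁆ ∪ ⁅ b ⁆) ∩ X)) ≡ # (f ∩ X)
#-exchange-∩ f {a} {b} X a∈f b∉f a∈X b∉X = begin
  suc (# (f′ ∩ X))       ≡⟨ +-comm 1 _ ⟩
  # (f′ ∩ X) + 1         ≡⟨ cong (λ u → # (f′ ∩ X) + ⟦ u ⟧) a∈X ⟨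
  # (f′ ∩ X) + ⟦ X a ⟧   ≡⟨ #-exchange f a∈f b∉f X ⟩
  # (f ∩ X) + ⟦ X b ⟧    ≡⟨ cong (λ u → # (f ∩ X) + ⟦ u ⟧) b∉X ⟩
  # (f ∩ X) + 0          ≡⟨ +-identityʳ _ ⟩
  # (f ∩ X)              ∎
  where
  open ≡-Reasoning
  f′ = f ∖ ⁅ a ⁆ ∪ ⁅ b ⁆

exchange-back : ∀ (f : Sub n) {a b} → a ∈ f → b ∉ f → (f ∖ ⁅ a ⁆ ∪ ⁅ b ⁆) ∖ ⁅ b ⁆ ∪ ⁅ a ⁆ ≗ f
exchange-back f {a} {b} a∈f b∉f x with x ≟ a | x ≟ b
... | yes refl | yes refl with () ← trans (sym a∈f) b∉f
... | yes refl | no _     = trans (∨-zeroʳ _) (sym a∈f)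
... | no _     | yes refl = trans (∨-identityʳ _) (trans (∧-zeroʳ _) (sym b∉f))
... | no _     | no _     = trans (∨-identityʳ _) (trans (∧-identityʳ _) (trans (∨-identityʳ _) (∧-identityʳ _)))

⊆-exchange-∪ : ∀ (f : Sub n) a b → f ⊆ (f ∖ ⁅ a ⁆ ∪ ⁅ b ⁆) ∪ ⁅ a ⁆
⊆-exchange-∪ f a b x x∈f with x ≟ a
... | yes _ = ∨-zeroʳ _
... | no _  rewrite x∈f = refl

exchange-⊆-∪ : ∀ (f : Sub n) a b → f ∖ ⁅ a ⁆ ∪ ⁅ b ⁆ ⊆ f ∪ ⁅ b ⁆
exchange-⊆-∪ f a b x x∈f′ with x ≟ b
... | yes _ = ∨-zeroʳ _
... | no _  = trans (∨-identityʳ (f x)) (∧-conicalˡ (f x) _ (trans (sym (∨-identityʳ _)) x∈f′))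

-- Subsets as vectors

∣∣≡# : ∀ (S : Subset n) → Subset.∣ S ∣ ≡ # (lookup S)
∣∣≡# Vec.[]            = refl
∣∣≡# (true  Vec.∷ S) = cong suc (∣∣≡# S)
∣∣≡# (false Vec.∷ S) = ∣∣≡# S

∣∩∣≡# : ∀ (S T : Subset n) → Subset.∣ S Subset.∩ T ∣ ≡ # (lookup S ∩ lookup T)
∣∩∣≡# S T = trans (∣∣≡# (S Subset.∩ T)) (#-cong (λ x → lookup-zipWith _∧_ x S T))

lookup-injective : ∀ {A : Set} {S T : Vec A n} → (∀ x → lookup S x ≡ lookup T x) → S ≡ T
lookup-injective {S = S} {T} S≗T =
  trans (sym (tabulate∘lookup S)) (trans (tabulate-cong S≗T) (tabulate∘lookup T))

lookup-swapIn : ∀ (S : Subset n) a b → lookup (swapIn b a S) ≗ lookup S ∖ ⁅ a ⁆ ∪ ⁅ b ⁆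
lookup-swapIn S a b x with x ≟ b | x ≟ a
... | yes refl | _        = trans (lookup∘update x S₋ true) (sym (∨-zeroʳ _))
  where S₋ = S Vec.[ a ]≔ false
... | no x≢b   | yes refl = trans (lookup∘update′ x≢b (S Vec.[ x ]≔ false) true)
  (trans (lookup∘update x S false) (sym (cong (_∨ false) (∧-zeroʳ (lookup S x)))))
... | no x≢b   | no x≢a   = trans (lookup∘update′ x≢b (S Vec.[ a ]≔ false) true)
  (trans (lookup∘update′ x≢a S false) (sym (trans (∨-identityʳ _) (∧-identityʳ _))))

swapIn-swapIn : ∀ (S : Subset n) {a b} → a ∈ lookup S → b ∉ lookup S → swapIn a b (swapIn b a S) ≡ S
swapIn-swapIn S {a} {b} a∈S b∉S = lookup-injective λ x →
  trans (lookup-swapIn (swapIn b a S) b a x)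
        (trans (cong (λ u → (u ∧ not (⁅ b ⁆ x)) ∨ ⁅ a ⁆ x) (lookup-swapIn S a b x))
               (exchange-back (lookup S) a∈S b∉S x))

∈-swapIn : ∀ (S : Subset n) a b → b ∈ lookup (swapIn b a S)
∈-swapIn S a b = trans (lookup-swapIn S a b b) (∈-exchange (lookup S) a b)

∉-swapIn : ∀ (S : Subset n) {a b} → ¬ a ≡ b → a ∉ lookup (swapIn b a S)
∉-swapIn S {a} {b} a≢b = trans (lookup-swapIn S a b a) (∉-exchange (lookup S) a≢b)

#-swapIn : ∀ (S : Subset n) {a b} → a ∈ lookup S → b ∉ lookup S → ∀ X →
  # (lookup (swapIn b a S) ∩ X) + ⟦ X a ⟧ ≡ # (lookup S ∩ X) + ⟦ X b ⟧
#-swapIn S {a} {b} a∈S b∉S X = trans (cong (_+ ⟦ X a ⟧) (#-cong (λ x → cong (_∧ X x) (lookup-swapIn S a b x))))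
                                     (#-exchange (lookup S) a∈S b∉S X)

#-swapIn-size : ∀ (S : Subset n) {a b} → a ∈ lookup S → b ∉ lookup S →
  # (lookup (swapIn b a S)) ≡ # (lookup S)
#-swapIn-size S {a} {b} a∈S b∉S = trans (#-cong (lookup-swapIn S a b)) (#-exchange-size (lookup S) a∈S b∉S)

#-swapIn-∩ : ∀ (S : Subset n) {a b} X → a ∈ lookup S → b ∉ lookup S → a ∈ X → b ∉ X →
  suc (# (lookup (swapIn b a S) ∩ X)) ≡ # (lookup S ∩ X)
#-swapIn-∩ S {a} {b} X a∈S b∉S a∈X b∉X = trans (cong suc (#-cong (λ x → cong (_∧ X x) (lookup-swapIn S a b x))))
                                               (#-exchange-∩ (lookup S) X a∈S b∉S a∈X b∉X)

lookup-permSet-transpose : ∀ (S : Subset n) a b x →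
  lookup (permSet (transpose a b) S) x ≡ lookup S (PC.transpose b a x)
lookup-permSet-transpose S a b = lookup∘tabulate _

permSet-transpose-fixed : ∀ (S : Subset n) {a b} → lookup S a ≡ lookup S b → permSet (transpose a b) S ≡ S
permSet-transpose-fixed S {a} {b} Sa≡Sb = lookup-injective λ x →
  trans (lookup-permSet-transpose S a b x) (fixed x)
  where
  fixed : ∀ x → lookup S (PC.transpose b a x) ≡ lookup S x
  fixed x with x ≟ b
  ... | yes refl = Sa≡Sb
  ... | no _ with x ≟ a
  ...   | yes refl = sym Sa≡Sb
  ...   | no _     = refl

permSet-transpose-swapIn : ∀ (S : Subset n) {a b} → a ∈ lookup S → b ∉ lookup S →
  permSet (transpose a b) S ≡ swapIn b a S
permSet-transpose-swapIn S {a} {b} a∈S b∉S = lookup-injective λ x →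
  trans (lookup-permSet-transpose S a b x) (trans (moved x) (sym (lookup-swapIn S a b x)))
  where
  moved : ∀ x → lookup S (PC.transpose b a x) ≡ (lookup S x ∧ not (⁅ a ⁆ x)) ∨ ⁅ b ⁆ x
  moved x with x ≟ b
  ... | yes refl = trans a∈S (sym (∨-zeroʳ _))
  ... | no _ with x ≟ a
  ...   | yes refl = trans b∉S (sym (trans (∨-identityʳ _) (∧-zeroʳ _)))
  ...   | no _     = sym (trans (∨-identityʳ _) (∧-identityʳ _))

permSet-transpose-swapIn′ : ∀ (S : Subset n) {a b} → a ∉ lookup S → b ∈ lookup S →
  permSet (transpose a b) S ≡ swapIn a b S
permSet-transpose-swapIn′ S {a} {b} a∉S b∈S = lookup-injective λ x →
  trans (lookup-permSet-transpose S a b x) (trans (moved x) (sym (lookup-swapIn S b a x)))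
  where
  moved : ∀ x → lookup S (PC.transpose b a x) ≡ (lookup S x ∧ not (⁅ b ⁆ x)) ∨ ⁅ a ⁆ x
  moved x with x ≟ b
  ... | yes refl with x ≟ a
  ...   | yes refl with () ← trans (sym b∈S) a∉S
  ...   | no _     = trans a∉S (sym (trans (∨-identityʳ _) (∧-zeroʳ _)))
  moved x | no _ with x ≟ a
  ...   | yes refl = trans b∈S (sym (∨-zeroʳ _))
  ...   | no _     = sym (trans (∨-identityʳ _) (∧-identityʳ _))

#-tabulate-∩ : ∀ (f X : Sub n) → # (lookup (tabulate f) ∩ X) ≡ # (f ∩ X)
#-tabulate-∩ f X = #-cong (λ x → cong (_∧ X x) (lookup∘tabulate f x))

permSet-id : ∀ (S : Subset n) → permSet id S ≡ S
permSet-id S = tabulate∘lookup S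

-- Shifting

_∉ᶠ_ : Subset n → Family n → Set
S ∉ᶠ 𝒜 = 𝒜 S ≡ false

module Shifting (i j : Fin n) where

  shiftSet-stays : ∀ (𝒢 : Family n) G → i ∈ lookup G ⊎ j ∉ lookup G ⊎ swapIn i j G ∈ᶠ 𝒢 →
    shiftSet i j 𝒢 G ≡ G
  shiftSet-stays 𝒢 G blocked with lookup G j | lookup G i | 𝒢 (swapIn i j G) | blocked
  ... | true  | true  | _     | _        = refl
  ... | true  | false | true  | _        = refl
  ... | true  | false | false | inj₁ ()
  ... | true  | false | false | inj₂ (inj₁ ())
  ... | true  | false | false | inj₂ (inj₂ ())
  ... | false | _     | _     | _        = refl

  shiftSet-stays-balanced : ∀ (𝒢 : Family n) G → lookup G i ≡ lookup G j → shiftSet i j 𝒢 G ≡ G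
  shiftSet-stays-balanced 𝒢 G Gi≡Gj with true-or-false (lookup G i)
  ... | inj₁ i∈G = shiftSet-stays 𝒢 G (inj₁ i∈G)
  ... | inj₂ i∉G = shiftSet-stays 𝒢 G (inj₂ (inj₁ (trans (sym Gi≡Gj) i∉G)))

  shiftSet-moves : ∀ (𝒢 : Family n) G → j ∈ lookup G → i ∉ lookup G → swapIn i j G ∉ᶠ 𝒢 →
    shiftSet i j 𝒢 G ≡ swapIn i j G
  shiftSet-moves 𝒢 G j∈G i∉G G′∉𝒢 rewrite j∈G | i∉G | G′∉𝒢 = refl

  shiftSet-cases : ∀ (𝒢 : Family n) G →
    shiftSet i j 𝒢 G ≡ G
    ⊎ (j ∈ lookup G × i ∉ lookup G × swapIn i j G ∉ᶠ 𝒢 × shiftSet i j 𝒢 G ≡ swapIn i j G)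
  shiftSet-cases 𝒢 G with lookup G j | lookup G i | 𝒢 (swapIn i j G)
  ... | true  | false | false = inj₂ (refl , refl , refl , refl)
  ... | true  | false | true  = inj₁ refl
  ... | true  | true  | _     = inj₁ refl
  ... | false | _     | _     = inj₁ refl

  Critical : Family n → Subset n → Set
  Critical ℱ G = G ∈ᶠ ℱ × i ∈ lookup G × j ∉ lookup G × swapIn j i G ∉ᶠ ℱ

  critical? : ∀ (ℱ : Family n) G → Dec (Critical ℱ G)
  critical? ℱ G =
    (ℱ G ≟ᵇ true) ×-dec (lookup G i ≟ᵇ true) ×-dec (lookup G j ≟ᵇ false) ×-dec (ℱ (swapIn j i G) ≟ᵇ false)

  module ShiftPreimage {X ℱ : Family n} (X↦ℱ : ShiftEq i j X ℱ) where

    image-∈ : ∀ {S} → S ∈ᶠ X → shiftSet i j X S ∈ᶠ ℱ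
    image-∈ S∈X = proj₁ (X↦ℱ _) (_ , S∈X , refl)

    preimage : ∀ {S} → S ∈ᶠ ℱ → ∃ λ G → G ∈ᶠ X × shiftSet i j X G ≡ S
    preimage = proj₂ (X↦ℱ _)

    critical-covered : ∀ {G} → Critical ℱ G → G ∈ᶠ X ⊎ swapIn j i G ∈ᶠ X
    critical-covered (G∈ℱ , _) with preimage G∈ℱ
    ... | H , H∈X , H↦G with shiftSet-cases X H
    ...   | inj₁ stays = inj₁ (subst (_∈ᶠ X) (trans (sym stays) H↦G) H∈X)
    ...   | inj₂ (j∈H , i∉H , _ , moves) =
      inj₂ (subst (_∈ᶠ X) (trans (sym (swapIn-swapIn H j∈H i∉H)) (cong (swapIn j i) (trans (sym moves) H↦G)))
                 H∈X)

    critical-exclusive : ∀ {G} → Critical ℱ G → G ∈ᶠ X → swapIn j i G ∈ᶠ X → ⊥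
    critical-exclusive {G} (_ , i∈G , j∉G , G′∉ℱ) G∈X G′∈X with shiftSet-cases X (swapIn j i G)
    ... | inj₁ stays = not-¬ (trans (cong ℱ stays) G′∉ℱ) (image-∈ G′∈X)
    ... | inj₂ (_ , _ , G∉X , _) = not-¬ (subst (_∉ᶠ X) (swapIn-swapIn G i∈G j∉G) G∉X) G∈X

    outside-critical : ∀ {S} → S ∉ᶠ ℱ → S ∈ᶠ X →
      Critical ℱ (swapIn i j S) × swapIn j i (swapIn i j S) ≡ S
    outside-critical {S} S∉ℱ S∈X with shiftSet-cases X S
    ... | inj₁ stays = ⊥-elim (not-¬ (subst (_∉ᶠ ℱ) (sym stays) S∉ℱ) (image-∈ S∈X))
    ... | inj₂ (j∈S , i∉S , _ , moves) =
      (subst (_∈ᶠ ℱ) moves (image-∈ S∈X) , ∈-swapIn S j i , ∉-swapIn S (∈∉⇒≢ (lookup S) j∈S i∉S) ,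
       subst (_∉ᶠ ℱ) (sym round-trip) S∉ℱ) , round-trip
      where round-trip = swapIn-swapIn S j∈S i∉S

    noncritical-∈ : ∀ {S} → S ∈ᶠ ℱ → ¬ Critical ℱ S → S ∈ᶠ X
    noncritical-∈ {S} S∈ℱ ¬crit with preimage S∈ℱ
    ... | H , H∈X , H↦S with shiftSet-cases X H
    ...   | inj₁ stays = subst (_∈ᶠ X) (trans (sym stays) H↦S) H∈X
    ...   | inj₂ (j∈H , i∉H , _ , moves) = ⊥-elim unreachable
      where
      S≡ : swapIn i j H ≡ S
      S≡ = trans (sym moves) H↦S
      i∈S : i ∈ lookup S
      i∈S = subst (λ T → i ∈ lookup T) S≡ (∈-swapIn H j i)
      j∉S : j ∉ lookup S
      j∉S = subst (λ T → j ∉ lookup T) S≡ (∉-swapIn H (∈∉⇒≢ (lookup H) j∈H i∉H))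
      H∈ℱ : H ∈ᶠ ℱ
      H∈ℱ with true-or-false (ℱ H)
      ... | inj₁ H∈ℱ = H∈ℱ
      ... | inj₂ H∉ℱ = ⊥-elim (¬crit (S∈ℱ , i∈S , j∉S ,
                         subst (_∉ᶠ ℱ) (sym (trans (cong (swapIn j i) (sym S≡)) (swapIn-swapIn H j∈H i∉H))) H∉ℱ))
      unreachable : ⊥
      unreachable with preimage H∈ℱ
      ... | H′ , H′∈X , H′↦H with shiftSet-cases X H′
      ...   | inj₁ stays′ = not-¬ i∉H (subst (λ T → i ∈ lookup T) S≡H i∈S)
        where
        H′≡H = trans (sym stays′) H′↦H
        S≡H : S ≡ H
        S≡H = trans (sym H↦S) (trans (cong (shiftSet i j X) (sym H′≡H)) (trans stays′ H′≡H))
      ...   | inj₂ (_ , _ , _ , moves′) =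
        not-¬ i∉H (subst (λ T → i ∈ lookup T) (trans (sym moves′) H′↦H) (∈-swapIn H′ j i))

  shift-determined : ∀ {X Y ℱ : Family n} → ShiftEq i j X ℱ → ShiftEq i j Y ℱ →
    (∀ G → Critical ℱ G → X G ≡ Y G) → X ≐ Y
  shift-determined {X} {Y} {ℱ} X↦ℱ Y↦ℱ agree S =
    ⇔→≡ (mk⇔ (transfer X↦ℱ Y↦ℱ agree) (transfer Y↦ℱ X↦ℱ (λ G c → sym (agree G c))))
    where
    transfer : ∀ {X Y} → ShiftEq i j X ℱ → ShiftEq i j Y ℱ → (∀ G → Critical ℱ G → X G ≡ Y G) →
               S ∈ᶠ X → S ∈ᶠ Y
    transfer {X} {Y} X↦ℱ Y↦ℱ agree S∈X with critical? ℱ S | ℱ S in S∈?ℱ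
    ... | yes crit | _     = trans (sym (agree S crit)) S∈X
    ... | no ¬crit | true  = ShiftPreimage.noncritical-∈ Y↦ℱ S∈?ℱ ¬crit
    ... | no ¬crit | false with ShiftPreimage.outside-critical X↦ℱ S∈?ℱ S∈X
    ...   | crit , round-trip with ShiftPreimage.critical-covered Y↦ℱ crit
    ...     | inj₂ S∈Y = subst (_∈ᶠ Y) round-trip S∈Y
    ...     | inj₁ G∈Y = ⊥-elim (ShiftPreimage.critical-exclusive X↦ℱ crit (trans (agree _ crit) G∈Y)
                                   (subst (_∈ᶠ X) (sym round-trip) S∈X))

  critical-edge : ∀ {t} {A B ℱ : Family n} → CrossInt t A B → ShiftEq i j A ℱ → ShiftEq i j B ℱ →
    ∀ {G K} → Critical ℱ G → Critical ℱ K → # (lookup G ∩ lookup K) ≤ t → A G ≡ B K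
  critical-edge {t} {A} {B} cross A↦ℱ B↦ℱ {G} {K} crit-G@(_ , i∈G , j∉G , _) crit-K@(_ , i∈K , j∉K , _)
                G∩K≤t = ⇔→≡ (mk⇔ A→B B→A)
    where
    meet : ∀ S T → S ∈ᶠ A → T ∈ᶠ B → t ≤ # (lookup S ∩ lookup T)
    meet S T S∈A T∈B = subst (t ≤_) (∣∩∣≡# S T) (cross S T S∈A T∈B)
    A→B : G ∈ᶠ A → K ∈ᶠ B
    A→B G∈A with B K | ShiftPreimage.critical-covered B↦ℱ crit-K
    ... | true  | _         = refl
    ... | false | inj₁ ()
    ... | false | inj₂ K′∈B = ⊥-elim (<⇒≱ (begin-strict
      # (lookup G ∩ lookup (swapIn j i K)) ≡⟨ #-∩-comm (lookup G) _ ⟩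
      # (lookup (swapIn j i K) ∩ lookup G) <⟨ ≤-reflexive (#-swapIn-∩ K (lookup G) i∈K j∉K i∈G j∉G) ⟩
      # (lookup K ∩ lookup G)              ≡⟨ #-∩-comm (lookup K) _ ⟩
      # (lookup G ∩ lookup K)              ≤⟨ G∩K≤t ⟩
      t                                    ∎) (meet G _ G∈A K′∈B))
      where open ≤-Reasoning
    B→A : K ∈ᶠ B → G ∈ᶠ A
    B→A K∈B with A G | ShiftPreimage.critical-covered A↦ℱ crit-G
    ... | true  | _         = refl
    ... | false | inj₁ ()
    ... | false | inj₂ G′∈A =
      ⊥-elim (<⇒≱ (<-≤-trans (≤-reflexive (#-swapIn-∩ G (lookup K) i∈G j∉G i∈K j∉K)) G∩K≤t)
                  (meet _ K G′∈A K∈B))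

  Shifted : Family n → Set
  Shifted ℱ = ∀ S → S ∈ᶠ ℱ → j ∈ lookup S → i ∉ lookup S → swapIn i j S ∈ᶠ ℱ

  module ShiftedFamily {ℱ : Family n} (shifted : Shifted ℱ) where

    shifted-stays : ∀ {G} → G ∈ᶠ ℱ → shiftSet i j ℱ G ≡ G
    shifted-stays {G} G∈ℱ with true-or-false (lookup G i) | true-or-false (lookup G j)
    ... | inj₁ i∈G | _        = shiftSet-stays ℱ G (inj₁ i∈G)
    ... | inj₂ _   | inj₂ j∉G = shiftSet-stays ℱ G (inj₂ (inj₁ j∉G))
    ... | inj₂ i∉G | inj₁ j∈G = shiftSet-stays ℱ G (inj₂ (inj₂ (shifted G G∈ℱ j∈G i∉G)))

    shift-fixes : ShiftEq i j ℱ ℱ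
    shift-fixes S = (λ { (G , G∈ℱ , G↦S) → subst (_∈ᶠ ℱ) (trans (sym (shifted-stays G∈ℱ)) G↦S) G∈ℱ })
                  , (λ S∈ℱ → S , S∈ℱ , shifted-stays S∈ℱ)

    transposed : Family n
    transposed S = ℱ (permSet (transpose i j) S)

    critical-∉-transposed : ∀ G → Critical ℱ G → G ∉ᶠ transposed
    critical-∉-transposed G (_ , i∈G , j∉G , G′∉ℱ) = trans (cong ℱ (permSet-transpose-swapIn G i∈G j∉G)) G′∉ℱ

    private
      transpose-swapIn : ∀ {G} → j ∈ lookup G → i ∉ lookup G → permSet (transpose i j) (swapIn i j G) ≡ G
      transpose-swapIn {G} j∈G i∉G =
        trans (permSet-transpose-swapIn (swapIn i j G) (∈-swapIn G j i) (∉-swapIn G (∈∉⇒≢ (lookup G) j∈G i∉G)))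
              (swapIn-swapIn G j∈G i∉G)

      into : ∀ {G} → G ∈ᶠ transposed → shiftSet i j transposed G ∈ᶠ ℱ
      into {G} G∈ with two-points (lookup G) i j
      ... | inj₁ Gi≡Gj = subst (_∈ᶠ ℱ) (sym (shiftSet-stays-balanced transposed G Gi≡Gj))
                                (subst (_∈ᶠ ℱ) (permSet-transpose-fixed G Gi≡Gj) G∈)
      ... | inj₂ (inj₁ (i∈G , j∉G)) = subst (_∈ᶠ ℱ) (sym (shiftSet-stays transposed G (inj₁ i∈G)))
                                  (subst (_∈ᶠ ℱ) (swapIn-swapIn G i∈G j∉G)
                           (shifted _ G′∈ℱ (∈-swapIn G i j) (∉-swapIn G (∈∉⇒≢ (lookup G) i∈G j∉G))))
        where G′∈ℱ = subst (_∈ᶠ ℱ) (permSet-transpose-swapIn G i∈G j∉G) G∈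
      ... | inj₂ (inj₂ (i∉G , j∈G)) with true-or-false (transposed (swapIn i j G))
      ...   | inj₁ G′∈ = subst (_∈ᶠ ℱ) (sym (shiftSet-stays transposed G (inj₂ (inj₂ G′∈))))
                            (subst (_∈ᶠ ℱ) (transpose-swapIn j∈G i∉G) G′∈)
      ...   | inj₂ G′∉ = subst (_∈ᶠ ℱ) (sym (shiftSet-moves transposed G j∈G i∉G G′∉))
                            (subst (_∈ᶠ ℱ) (permSet-transpose-swapIn′ G i∉G j∈G) G∈)

      onto : ∀ {S} → S ∈ᶠ ℱ → ∃ λ G → G ∈ᶠ transposed × shiftSet i j transposed G ≡ S
      onto {S} S∈ℱ with two-points (lookup S) i j
      ... | inj₁ Si≡Sj =
        S , subst (_∈ᶠ ℱ) (sym (permSet-transpose-fixed S Si≡Sj)) S∈ℱ , shiftSet-stays-balanced transposed S Si≡Sj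
      ... | inj₂ (inj₂ (i∉S , j∈S)) =
        S , subst (_∈ᶠ ℱ) (sym (permSet-transpose-swapIn′ S i∉S j∈S)) (shifted S S∈ℱ j∈S i∉S)
          , shiftSet-stays transposed S (inj₂ (inj₂ (subst (_∈ᶠ ℱ) (sym (transpose-swapIn j∈S i∉S)) S∈ℱ)))
      ... | inj₂ (inj₁ (i∈S , j∉S)) with true-or-false (ℱ (swapIn j i S))
      ...   | inj₁ S′∈ℱ = S , subst (_∈ᶠ ℱ) (sym (permSet-transpose-swapIn S i∈S j∉S)) S′∈ℱ
                            , shiftSet-stays transposed S (inj₁ i∈S)
      ...   | inj₂ S′∉ℱ =
        swapIn j i S , S′∈ , trans (shiftSet-moves transposed _ (∈-swapIn S i j) (∉-swapIn S i≢j) S∉) round-trip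
        where
        i≢j = ∈∉⇒≢ (lookup S) i∈S j∉S
        round-trip = swapIn-swapIn S i∈S j∉S
        S′∈ : swapIn j i S ∈ᶠ transposed
        S′∈ = subst (_∈ᶠ ℱ)
                    (sym (trans (permSet-transpose-swapIn′ _ (∉-swapIn S i≢j) (∈-swapIn S i j)) round-trip)) S∈ℱ
        S∉ : swapIn i j (swapIn j i S) ∉ᶠ transposed
        S∉ = subst (_∉ᶠ transposed) (sym round-trip) (trans (cong ℱ (permSet-transpose-swapIn S i∈S j∉S)) S′∉ℱ)

    shift-transposed : ShiftEq i j transposed ℱ
    shift-transposed S = (λ { (G , G∈ , G↦S) → subst (_∈ᶠ ℱ) G↦S (into {G} G∈) }) , onto

-- Arithmetic

two-outer-parts-fit : ∀ {n k t ℓ r} c → t + ℓ + r ≡ k → 2 * k + c ≤ n + t → t + 2 * ℓ + (r + r + c) ≤ n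
two-outer-parts-fit {n} {t = t} {ℓ} {r} c refl 2k+c≤n+t =
  +-cancelʳ-≤ t _ n (subst (_≤ n + t) (regroup t ℓ r c) 2k+c≤n+t)
  where
  regroup : ∀ t ℓ r c → 2 * (t + ℓ + r) + c ≡ t + 2 * ℓ + (r + r + c) + t
  regroup = solve-∀

ℓ≤-after-two-removals : ∀ {t ℓ s} → 2 ≤ t → t + ℓ ≤ 2 + s → ℓ ≤ s
ℓ≤-after-two-removals {ℓ = ℓ} {s} 2≤t t+ℓ≤2+s = +-cancelˡ-≤ 2 ℓ s (≤-trans (+-monoˡ-≤ ℓ 2≤t) t+ℓ≤2+s)

r≤-after-two-removals : ∀ {m r w s n} → m + (r + w) ≡ n → w ≤ 2 + s → m + (r + r + 2) ≤ n → r ≤ s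
r≤-after-two-removals {m} {r} {w} {s} refl w≤2+s fits =
  +-cancelʳ-≤ 2 r s (≤-trans r+2≤w (≤-trans w≤2+s (≤-reflexive (+-comm 2 s))))
  where
  r+2≤w : r + 2 ≤ w
  r+2≤w = +-cancelˡ-≤ r (r + 2) w (subst (_≤ r + w) (+-assoc r r 2) (+-cancelˡ-≤ m _ _ fits))

+-2*-split : ∀ t ℓ → t + 2 * ℓ ≡ t + ℓ + ℓ
+-2*-split = solve-∀

x+ℓ≡t+2ℓ⇒x≡t+ℓ : ∀ {x t ℓ} → x + ℓ ≡ t + 2 * ℓ → x ≡ t + ℓ
x+ℓ≡t+2ℓ⇒x≡t+ℓ {x} {t} {ℓ} x+ℓ≡ = +-cancelʳ-≡ ℓ x (t + ℓ) (trans x+ℓ≡ (+-2*-split t ℓ))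

few-inside : ∀ {y d e c t ℓ} → y + d ≡ t + ℓ → e ≤ d → c + e ≡ t + 2 * ℓ → c < t + ℓ → y < t
few-inside {y} {d} {e} {c} {t} {ℓ} y+d≡ e≤d c+e≡ c<t+ℓ = +-cancelʳ-≤ ℓ (suc y) t (begin
  suc y + ℓ ≡⟨ +-suc y ℓ ⟨
  y + suc ℓ ≤⟨ +-monoʳ-≤ y (≤-trans ℓ<e e≤d) ⟩
  y + d     ≡⟨ y+d≡ ⟩
  t + ℓ     ∎)
  where
  open ≤-Reasoning
  ℓ<e : ℓ < e
  ℓ<e = +-cancelˡ-< c ℓ e (begin-strict
    c + ℓ         <⟨ +-monoˡ-< ℓ c<t+ℓ ⟩
    t + ℓ + ℓ     ≡⟨ trans c+e≡ (+-2*-split t ℓ) ⟨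
    c + e         ∎)

few-outside : ∀ {x z k n t} → x + z ≤ k → k + z ≡ n → 2 * k + 1 ≤ n + t → x < t
few-outside {x} {z} {k} {n} {t} x+z≤k refl 2k+1≤n+t = +-cancelʳ-≤ (k + z) (suc x) t (begin
  suc x + (k + z)   ≡⟨ regroup x z k ⟩
  x + z + suc k     ≤⟨ +-monoˡ-≤ (suc k) x+z≤k ⟩
  k + suc k         ≡⟨ double k ⟩
  2 * k + 1         ≤⟨ 2k+1≤n+t ⟩
  k + z + t         ≡⟨ +-comm (k + z) t ⟩
  t + (k + z)       ∎)
  where
  open ≤-Reasoning
  regroup : ∀ x z k → suc x + (k + z) ≡ x + z + suc k
  regroup = solve-∀
  double : ∀ k → k + suc k ≡ 2 * k + 1
  double = solve-∀

outer-size : ∀ {k} t ℓ → ℓ + t ≤ k → ∃ λ r → t + ℓ + r ≡ k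
outer-size t ℓ ℓ+t≤k with m≤n⇒∃[o]m+o≡n ℓ+t≤k
... | r , ℓ+t+r≡k = r , trans (cong (_+ r) (+-comm t ℓ)) ℓ+t+r≡k

+-≤-≡ : ∀ {a b c d} → a + b ≡ c + d → c ≤ a → d ≤ b → a ≡ c × b ≡ d
+-≤-≡ {a} {b} {c} {d} a+b≡c+d c≤a d≤b = a≡c , +-cancelˡ-≡ c b d (trans (cong (_+ b) (sym a≡c)) a+b≡c+d)
  where
  a≡c : a ≡ c
  a≡c = ≤-antisym (+-cancelʳ-≤ b a c (≤-trans (≤-reflexive a+b≡c+d) (+-monoʳ-≤ c d≤b))) c≤a

exchange-drop : ∀ {c′ c N} p q → c′ + ⟦ p ⟧ ≡ c + ⟦ q ⟧ → c′ < N → N ≤ c →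
  p ≡ true × q ≡ false × c ≡ N
exchange-drop {c′} {c} true  false c′+1≡c+0 c′<N N≤c =
  refl , refl , ≤-antisym (subst (_≤ _) (trans (+-comm 1 c′) (trans c′+1≡c+0 (+-identityʳ c))) c′<N) N≤c
exchange-drop {c′} {c} true  true  c′+1≡c+1 c′<N N≤c =
  ⊥-elim (<⇒≱ (subst (_< _) (+-cancelʳ-≡ 1 c′ c c′+1≡c+1) c′<N) N≤c)
exchange-drop {c′} {c} false false c′+0≡c+0 c′<N N≤c =
  ⊥-elim (<⇒≱ (subst (_< _) (+-cancelʳ-≡ 0 c′ c c′+0≡c+0) c′<N) N≤c)
exchange-drop {c′} {c} false true  c′+0≡c+1 c′<N N≤c = ⊥-elim (<⇒≱ (<-trans c<c′ c′<N) N≤c)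
  where
  c<c′ : c < c′
  c<c′ = ≤-reflexive (trans (+-comm 1 c) (trans (sym c′+0≡c+1) (+-identityʳ c′)))

-- The family F_ℓ^t(n,k)

segment : ℕ → Sub n
segment m x = toℕ x <ᵇ m

#-segment : ∀ m → m ≤ n → # (segment {n} m) ≡ m
#-segment {n} zero _ = #-empty {n} (λ x → below-zero (toℕ x))
  where
  below-zero : ∀ a → (a <ᵇ 0) ≡ false
  below-zero zero    = refl
  below-zero (suc a) = refl
#-segment (suc m) (s≤s m≤n) = cong suc (#-segment m m≤n)

segment-downward : ∀ {m} {a b : Fin n} → toℕ a ≤ toℕ b → b ∈ segment m → a ∈ segment m
segment-downward {m = m} {a} {b} a≤b b∈M =
  Equivalence.to T-≡ (<⇒<ᵇ (≤-<-trans a≤b (<ᵇ⇒< (toℕ b) m (Equivalence.from T-≡ b∈M))))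

module FamStructure (n k t ℓ : ℕ) where

  M : Sub n
  M = segment (t + 2 * ℓ)

  F : Family n
  F = Fam n k t ℓ

  F-by-counts : ∀ S → F S ≡ (# (lookup S) ≡ᵇ k) ∧ (t + ℓ ≤ᵇ # (lookup S ∩ M))
  F-by-counts S = cong₂ (λ u v → (u ≡ᵇ k) ∧ (t + ℓ ≤ᵇ v)) (∣∣≡# S)
    (trans (∣∩∣≡# S _) (#-cong (λ x → cong (lookup S x ∧_) (lookup∘tabulate _ x))))

  ∈F⁺ : ∀ S → # (lookup S) ≡ k → t + ℓ ≤ # (lookup S ∩ M) → S ∈ᶠ F
  ∈F⁺ S #S≡k t+ℓ≤ = trans (F-by-counts S)
    (cong₂ _∧_ (Equivalence.to T-≡ (≡⇒≡ᵇ _ _ #S≡k)) (Equivalence.to T-≡ (≤⇒≤ᵇ t+ℓ≤)))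

  ∈F⁻ : ∀ S → S ∈ᶠ F → # (lookup S) ≡ k × t + ℓ ≤ # (lookup S ∩ M)
  ∈F⁻ S S∈F = ≡ᵇ⇒≡ _ _ (Equivalence.from T-≡ (∧-conicalˡ _ _ counts))
            , ≤ᵇ⇒≤ _ _ (Equivalence.from T-≡ (∧-conicalʳ _ _ counts))
    where counts = trans (sym (F-by-counts S)) S∈F

  ∉F⁺ : ∀ S → # (lookup S ∩ M) < t + ℓ → S ∉ᶠ F
  ∉F⁺ S small = ¬-not λ S∈F → <⇒≱ small (proj₂ (∈F⁻ S S∈F))

  ∉F⁻ : ∀ S → S ∉ᶠ F → # (lookup S) ≡ k → # (lookup S ∩ M) < t + ℓ
  ∉F⁻ S S∉F #S≡k = ≰⇒> λ t+ℓ≤ → not-¬ S∉F (∈F⁺ S #S≡k t+ℓ≤)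

  module _ (i j : Fin n) where
    open Shifting i j

    Tight : Sub n → Set
    Tight f = # f ≡ k × i ∈ f × j ∉ f × # (f ∩ M) ≡ t + ℓ

    Tight-tabulate : ∀ {f} → Tight f → Tight (lookup (tabulate f))
    Tight-tabulate {f} (#f≡k , i∈f , j∉f , #f∩M) =
      trans (#-cong (lookup∘tabulate f)) #f≡k , trans (lookup∘tabulate f i) i∈f , trans (lookup∘tabulate f j) j∉f ,
      trans (#-tabulate-∩ f M) #f∩M

    critical⇒tight : ∀ G → Critical F G → Tight (lookup G) × i ∈ M × j ∉ M
    critical⇒tight G (G∈F , i∈G , j∉G , G′∉F) with ∈F⁻ G G∈F
    ... | #G≡k , t+ℓ≤ with exchange-drop (M i) (M j) (#-swapIn G i∈G j∉G M)
                             (∉F⁻ (swapIn j i G) G′∉F (trans (#-swapIn-size G i∈G j∉G) #G≡k)) t+ℓ≤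
    ...   | i∈M , j∉M , #G∩M = (#G≡k , i∈G , j∉G , #G∩M) , i∈M , j∉M

    tight⇒critical : ∀ G → i ∈ M → j ∉ M → Tight (lookup G) → Critical F G
    tight⇒critical G i∈M j∉M (#G≡k , i∈G , j∉G , #G∩M) =
      ∈F⁺ G #G≡k (≤-reflexive (sym #G∩M)) , i∈G , j∉G ,
      ∉F⁺ (swapIn j i G) (≤-reflexive (trans (#-swapIn-∩ G M i∈G j∉G i∈M j∉M) #G∩M))

    F-shifted : i <ᶠ j → Shifted F
    F-shifted i<j S S∈F j∈S i∉S with ∈F⁻ S S∈F
    ... | #S≡k , t+ℓ≤ = ∈F⁺ (swapIn i j S) (trans (#-swapIn-size S j∈S i∉S) #S≡k) (≤-trans t+ℓ≤ grows)
      where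
      j∈M⇒i∈M : j ∈ M → i ∈ M
      j∈M⇒i∈M = segment-downward {m = t + 2 * ℓ} (<⇒≤ i<j)
      grows : # (lookup S ∩ M) ≤ # (lookup (swapIn i j S) ∩ M)
      grows = +-cancelʳ-≤ ⟦ M i ⟧ _ _ (begin
        # (lookup S ∩ M) + ⟦ M i ⟧              ≡⟨ #-swapIn S j∈S i∉S M ⟨
        # (lookup (swapIn i j S) ∩ M) + ⟦ M j ⟧ ≤⟨ +-monoʳ-≤ _ (⟦⟧-mono j∈M⇒i∈M) ⟩
        # (lookup (swapIn i j S) ∩ M) + ⟦ M i ⟧ ∎)
        where open ≤-Reasoning

  module Carving (i j : Fin n) (i∈M : i ∈ M) (j∉M : j ∉ M) (r : ℕ) (size : t + ℓ + r ≡ k)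
                 (M≤n : t + 2 * ℓ ≤ n) {D W : Sub n} (D⊆M : D ⊆ M) (#D≡ℓ : # D ≡ ℓ)
                 (W⊆∁M : W ⊆ ∁ M) (#W≡r : # W ≡ r) where

    K : Sub n
    K = M ∖ D ∪ W

    private
      W-avoids-M : ∀ x → x ∈ M → x ∉ W
      W-avoids-M x x∈M = ¬-not λ x∈W → not-¬ (∈∁⁻ M x (W⊆∁M x x∈W)) x∈M

      #M∖D : # (M ∖ D) ≡ t + ℓ
      #M∖D = x+ℓ≡t+2ℓ⇒x≡t+ℓ (trans (cong (# (M ∖ D) +_) (sym #D≡ℓ)) (trans (#-∖-⊆ D⊆M) (#-segment _ M≤n)))

    carved-tight : i ∉ D → j ∉ W → Tight i j K
    carved-tight i∉D j∉W = #K , i∈K , j∉K , #K∩M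
      where
      #K : # K ≡ k
      #K = trans (#-∪ {f = M ∖ D} {W} λ x x∈M∖D → W-avoids-M x (proj₁ (∈∖⁻ M D x x∈M∖D)))
                 (trans (cong₂ _+_ #M∖D #W≡r) size)
      i∈K : i ∈ K
      i∈K rewrite i∈M | i∉D = refl
      j∉K : j ∉ K
      j∉K rewrite j∉M = j∉W
      K∩M≗M∖D : K ∩ M ≗ M ∖ D
      K∩M≗M∖D x with M x in x∈?M
      ... | false = ∧-zeroʳ _
      ... | true  rewrite W-avoids-M x x∈?M = trans (∧-identityʳ _) (∨-identityʳ _)
      #K∩M : # (K ∩ M) ≡ t + ℓ
      #K∩M = trans (#-cong K∩M≗M∖D) #M∖D

    carved-meets : ∀ {X} → Tight i j X → D ⊆ X → Disjoint X W → # (X ∩ K) ≡ t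
    carved-meets {X} (_ , _ , _ , #X∩M) D⊆X X∩W≡∅ = +-cancelʳ-≡ ℓ _ t (begin
      # (X ∩ K) + ℓ   ≡⟨ cong (# (X ∩ K) +_) #D≡ℓ ⟨
      # (X ∩ K) + # D ≡⟨ #-∩-carve (λ x x∈D → cong₂ _∧_ (D⊆X x x∈D) (D⊆M x x∈D)) X∩W≡∅ ⟩
      # (X ∩ M)       ≡⟨ #X∩M ⟩
      t + ℓ           ∎)
      where open ≡-Reasoning

  module TightGraph (i j : Fin n) (i∈M : i ∈ M) (j∉M : j ∉ M) (r : ℕ) (size : t + ℓ + r ≡ k)
                    (2≤t : 2 ≤ t) (fits : t + 2 * ℓ + (r + r + 2) ≤ n) where

    M≤n : t + 2 * ℓ ≤ n
    M≤n = ≤-trans (m≤m+n _ _) fits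

    #-outside : ∀ {G} → Tight i j G → # (G ∖ M) ≡ r
    #-outside {G} (#G≡k , _ , _ , #G∩M) = +-cancelˡ-≡ (t + ℓ) _ _ (begin
      t + ℓ + # (G ∖ M)     ≡⟨ cong (_+ # (G ∖ M)) #G∩M ⟨
      # (G ∩ M) + # (G ∖ M) ≡⟨ #-split G M ⟨
      # G                   ≡⟨ #G≡k ⟩
      k                     ≡⟨ size ⟨
      t + ℓ + r             ∎)
      where open ≡-Reasoning

    inner-pool : ∀ {G} a → Tight i j G → ℓ ≤ # (G ∩ M ∖ ⁅ a ⁆ ∖ ⁅ i ⁆)
    inner-pool {G} a (_ , _ , _ , #G∩M) = ℓ≤-after-two-removals 2≤t (begin
      t + ℓ                           ≡⟨ #G∩M ⟨
      # (G ∩ M)                       ≤⟨ #-≤-∖⁅⁆ (G ∩ M) a ⟩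
      suc (# (G ∩ M ∖ ⁅ a ⁆))         ≤⟨ s≤s (#-≤-∖⁅⁆ (G ∩ M ∖ ⁅ a ⁆) i) ⟩
      2 + # (G ∩ M ∖ ⁅ a ⁆ ∖ ⁅ i ⁆)   ∎)
      where open ≤-Reasoning

    outer-pool : ∀ {G} b → Tight i j G → r ≤ # (∁ M ∖ G ∖ ⁅ b ⁆ ∖ ⁅ j ⁆)
    outer-pool {G} b tight-G = r≤-after-two-removals {t + 2 * ℓ} n≡
      (≤-trans (#-≤-∖⁅⁆ (∁ M ∖ G) b) (s≤s (#-≤-∖⁅⁆ (∁ M ∖ G ∖ ⁅ b ⁆) j))) fits
      where
      n≡ : t + 2 * ℓ + (r + # (∁ M ∖ G)) ≡ n
      n≡ = begin
        t + 2 * ℓ + (r + # (∁ M ∖ G))           ≡⟨ cong₂ (λ u v → u + (v + # (∁ M ∖ G))) (#-segment _ M≤n)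
                                                          (trans (#-∩-comm (∁ M) G) (#-outside tight-G)) ⟨
        # M + (# (∁ M ∩ G) + # (∁ M ∖ G))       ≡⟨ cong (# M +_) (#-split (∁ M) G) ⟨
        # M + # (∁ M)                           ≡⟨ #-∁ M ⟩
        n                                       ∎
        where open ≡-Reasoning

    common-neighbour : ∀ {G H} a b → Tight i j G → Tight i j H → G ⊆ H ∪ ⁅ a ⁆ → H ⊆ G ∪ ⁅ b ⁆ →
      Σ[ K ∈ Sub n ] Tight i j K × # (G ∩ K) ≡ t × # (H ∩ K) ≡ t
    common-neighbour {G} {H} a b tight-G tight-H G⊆H∪a H⊆G∪b
      with pick (G ∩ M ∖ ⁅ a ⁆ ∖ ⁅ i ⁆) ℓ (inner-pool a tight-G)
         | pick (∁ M ∖ G ∖ ⁅ b ⁆ ∖ ⁅ j ⁆) r (outer-pool b tight-G)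
    ... | D , D⊆pool , #D≡ℓ | W , W⊆pool , #W≡r =
      K , carved-tight i∉D j∉W , carved-meets tight-G D⊆G G∩W≡∅ , carved-meets tight-H D⊆H H∩W≡∅
      where
      D-member : ∀ x → x ∈ D → x ∈ G × x ∈ M × ¬ x ≡ a × ¬ x ≡ i
      D-member x x∈D with ∈∖⁅⁆⁻ (G ∩ M ∖ ⁅ a ⁆) i x (D⊆pool x x∈D)
      ... | x∈G∩M∖a , x≢i with ∈∖⁅⁆⁻ (G ∩ M) a x x∈G∩M∖a
      ...   | x∈G∩M , x≢a with ∈∩⁻ G M x x∈G∩M
      ...     | x∈G , x∈M = x∈G , x∈M , x≢a , x≢i
      W-member : ∀ x → x ∈ W → x ∉ M × x ∉ G × ¬ x ≡ b × ¬ x ≡ j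
      W-member x x∈W with ∈∖⁅⁆⁻ (∁ M ∖ G ∖ ⁅ b ⁆) j x (W⊆pool x x∈W)
      ... | x∈∁M∖G∖b , x≢j with ∈∖⁅⁆⁻ (∁ M ∖ G) b x x∈∁M∖G∖b
      ...   | x∈∁M∖G , x≢b with ∈∖⁻ (∁ M) G x x∈∁M∖G
      ...     | x∈∁M , x∉G = ∈∁⁻ M x x∈∁M , x∉G , x≢b , x≢j
      D⊆M : D ⊆ M
      D⊆M x x∈D = proj₁ (proj₂ (D-member x x∈D))
      D⊆G : D ⊆ G
      D⊆G x x∈D = proj₁ (D-member x x∈D)
      D⊆H : D ⊆ H
      D⊆H x x∈D = ∈∪⁅⁆⁻ H a x (G⊆H∪a x (D⊆G x x∈D)) (proj₁ (proj₂ (proj₂ (D-member x x∈D))))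
      i∉D : i ∉ D
      i∉D = ¬-not λ i∈D → proj₂ (proj₂ (proj₂ (D-member i i∈D))) refl
      W⊆∁M : W ⊆ ∁ M
      W⊆∁M x x∈W = cong not (proj₁ (W-member x x∈W))
      j∉W : j ∉ W
      j∉W = ¬-not λ j∈W → proj₂ (proj₂ (proj₂ (W-member j j∈W))) refl
      G∩W≡∅ : Disjoint G W
      G∩W≡∅ x x∈G = ¬-not λ x∈W → not-¬ (proj₁ (proj₂ (W-member x x∈W))) x∈G
      H∩W≡∅ : Disjoint H W
      H∩W≡∅ x x∈H = ¬-not λ x∈W → let (_ , x∉G , x≢b , _) = W-member x x∈W in
                                   not-¬ x∉G (∈∪⁅⁆⁻ G b x (H⊆G∪b x x∈H) x≢b)
      open Carving i j i∈M j∉M r size M≤n D⊆M #D≡ℓ W⊆∁M #W≡r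

    exchange-candidates : ∀ {G H} → Tight i j G → Tight i j H → 0 < # (G ∖ H) →
      ∃ λ a → ∃ λ b → a ∈ G ∖ H × b ∈ H ∖ G × M a ≡ M b
    exchange-candidates {G} {H} tight-G@(_ , _ , _ , #G∩M) tight-H@(_ , _ , _ , #H∩M) 0<#G∖H
      with 0 <? # (G ∖ H ∩ M)
    ... | yes 0<inside
      with #-nonempty 0<inside | exchange-partner {f = G} {H} {M} (trans #G∩M (sym #H∩M)) 0<inside
    ...   | a , a∈ | b , b∈ with ∈∩⁻ (G ∖ H) M a a∈ | ∈∩⁻ (H ∖ G) M b b∈
    ...     | a∈G∖H , a∈M | b∈H∖G , b∈M = a , b , a∈G∖H , b∈H∖G , trans a∈M (sym b∈M)
    exchange-candidates {G} {H} tight-G tight-H 0<#G∖H | no ¬0<inside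
      with #-nonempty 0<outside
         | exchange-partner {f = G} {H} {∁ M} (trans (#-outside tight-G) (sym (#-outside tight-H))) 0<outside
      where
      0<outside : 0 < # (G ∖ H ∖ M)
      0<outside = subst (0 <_) (trans (#-split (G ∖ H) M) (cong (_+ # (G ∖ H ∖ M)) (n≤0⇒n≡0 (≮⇒≥ ¬0<inside))))
                        0<#G∖H
    ... | a , a∈ | b , b∈ with ∈∩⁻ (G ∖ H) (∁ M) a a∈ | ∈∩⁻ (H ∖ G) (∁ M) b b∈
    ...   | a∈G∖H , a∉M | b∈H∖G , b∉M =
      a , b , a∈G∖H , b∈H∖G , trans (∈∁⁻ M a a∉M) (sym (∈∁⁻ M b b∉M))

    tight-exchange : ∀ {G H a b} → Tight i j G → Tight i j H → a ∈ G ∖ H → b ∈ H ∖ G → M a ≡ M b →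
      Tight i j (G ∖ ⁅ a ⁆ ∪ ⁅ b ⁆)
    tight-exchange {G} {H} {a} {b} (#G≡k , i∈G , j∉G , #G∩M) (_ , i∈H , j∉H , _) a∈G∖H b∈H∖G Ma≡Mb =
      trans (#-exchange-size G a∈G b∉G) #G≡k ,
      trans (exchange-other G (∈∉⇒≢ H i∈H a∉H) (∈∉⇒≢ G i∈G b∉G)) i∈G ,
      trans (exchange-other G (λ j≡a → ∈∉⇒≢ G a∈G j∉G (sym j≡a)) (λ j≡b → ∈∉⇒≢ H b∈H j∉H (sym j≡b)))
            j∉G ,
      trans (+-cancelʳ-≡ ⟦ M b ⟧ _ _ (trans (cong (λ u → # (G′ ∩ M) + ⟦ u ⟧) (sym Ma≡Mb)) (#-exchange G a∈G b∉G M)))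
            #G∩M
      where
      a∈G = proj₁ (∈∖⁻ G H a a∈G∖H)
      a∉H = proj₂ (∈∖⁻ G H a a∈G∖H)
      b∈H = proj₁ (∈∖⁻ H G b b∈H∖G)
      b∉G = proj₂ (∈∖⁻ H G b b∈H∖G)
      G′ = G ∖ ⁅ a ⁆ ∪ ⁅ b ⁆

    tight-connected : (χ : Sub n → Bool) →
      (∀ {G H} a b → Tight i j G → Tight i j H → G ⊆ H ∪ ⁅ a ⁆ → H ⊆ G ∪ ⁅ b ⁆ → χ G ≡ χ H) →
      ∀ {G H} → Tight i j G → Tight i j H → χ G ≡ χ H
    tight-connected χ close tight-G tight-H = along _ tight-G tight-H refl
      where
      along : ∀ d {G H} → Tight i j G → Tight i j H → # (G ∖ H) ≡ d → χ G ≡ χ H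
      along zero {G} {H} tight-G@(#G≡k , _) tight-H@(#H≡k , _) #G∖H≡0 =
        close i i tight-G tight-H (⊆⇒⊆∪ ⁅ i ⁆ (#∖≡0⇒⊆ #G∖H≡0))
                                  (⊆⇒⊆∪ ⁅ i ⁆ (#∖≡0⇒⊆ #H∖G≡0))
        where #H∖G≡0 = trans (sym (#-∖-comm {f = G} {H} (trans #G≡k (sym #H≡k)))) #G∖H≡0
      along (suc d) {G} {H} tight-G tight-H #G∖H≡1+d
        with exchange-candidates tight-G tight-H (subst (0 <_) (sym #G∖H≡1+d) (s≤s z≤n))
      ... | a , b , a∈G∖H , b∈H∖G , Ma≡Mb =
        trans (close a b tight-G tight-G′ (⊆-exchange-∪ G a b) (exchange-⊆-∪ G a b))
              (along d tight-G′ tight-H (suc-injective (trans closer #G∖H≡1+d)))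
        where
        tight-G′ = tight-exchange tight-G tight-H a∈G∖H b∈H∖G Ma≡Mb
        closer : suc (# ((G ∖ ⁅ a ⁆ ∪ ⁅ b ⁆) ∖ H)) ≡ # (G ∖ H)
        closer = #-exchange-∩ G (∁ H) (proj₁ (∈∖⁻ G H a a∈G∖H)) (proj₂ (∈∖⁻ H G b b∈H∖G))
                   (cong not (proj₂ (∈∖⁻ G H a a∈G∖H))) (cong not (proj₁ (∈∖⁻ H G b b∈H∖G)))

  module Avoidance (r : ℕ) (size : t + ℓ + r ≡ k) (1≤t : 1 ≤ t) (2k+1≤n+t : 2 * k + 1 ≤ n + t) where

    fits : t + 2 * ℓ + (r + r + 1) ≤ n
    fits = two-outer-parts-fit 1 size 2k+1≤n+t

    M≤n : t + 2 * ℓ ≤ n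
    M≤n = ≤-trans (m≤m+n _ _) fits

    avoider : ∀ (b : Sub n) → # b ≡ k → # (b ∩ M) < t + ℓ →
      Σ[ A ∈ Sub n ] # A ≡ k × t + ℓ ≤ # (A ∩ M) × # (A ∩ b) < t
    avoider b #b≡k few-in-M
      with pick-avoiding M b (t + ℓ) (subst (t + ℓ ≤_) (sym (#-segment _ M≤n)) (+-monoʳ-≤ t (m≤m+n ℓ (ℓ + 0))))
    ... | Y , Y⊆M , #Y≡t+ℓ , Y-choice with pick-avoiding (∁ Y) b r r≤#∁Y
      where
      r≤#∁Y : r ≤ # (∁ Y)
      r≤#∁Y = +-cancelˡ-≤ (t + ℓ) r _ (begin
        t + ℓ + r                 ≤⟨ m≤m+n (t + ℓ + r) (ℓ + r + 1) ⟩
        t + ℓ + r + (ℓ + r + 1)   ≡⟨ regroup t ℓ r ⟩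
        t + 2 * ℓ + (r + r + 1)   ≤⟨ fits ⟩
        n                         ≡⟨ #-∁ Y ⟨
        # Y + # (∁ Y)             ≡⟨ cong (_+ # (∁ Y)) #Y≡t+ℓ ⟩
        t + ℓ + # (∁ Y)           ∎)
        where
        open ≤-Reasoning
        regroup : ∀ t ℓ r → t + ℓ + r + (ℓ + r + 1) ≡ t + 2 * ℓ + (r + r + 1)
        regroup = solve-∀
    ... | Y₂ , Y₂⊆∁Y , #Y₂≡r , Y₂-choice = Y ∪ Y₂ , #A≡k , t+ℓ≤#A∩M , few-in-b Y₂-choice
      where
      Y∩Y₂≡∅ : Disjoint Y Y₂
      Y∩Y₂≡∅ x x∈Y = ¬-not λ x∈Y₂ → not-¬ (∈∁⁻ Y x (Y₂⊆∁Y x x∈Y₂)) x∈Y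
      #A≡k : # (Y ∪ Y₂) ≡ k
      #A≡k = trans (#-∪ Y∩Y₂≡∅) (trans (cong₂ _+_ #Y≡t+ℓ #Y₂≡r) size)
      t+ℓ≤#A∩M : t + ℓ ≤ # ((Y ∪ Y₂) ∩ M)
      t+ℓ≤#A∩M = subst (_≤ # ((Y ∪ Y₂) ∩ M)) #Y≡t+ℓ
                       (#-mono λ x x∈Y → cong₂ _∧_ (cong (_∨ Y₂ x) x∈Y) (Y⊆M x x∈Y))
      few-in-b : Disjoint Y₂ b ⊎ ∁ Y ∖ b ⊆ Y₂ → # ((Y ∪ Y₂) ∩ b) < t
      few-in-b (inj₂ ∁Y∖b⊆Y₂) = few-outside {z = # (∁ b)} (begin
        # ((Y ∪ Y₂) ∩ b) + # (∁ b)           ≤⟨ +-monoʳ-≤ _ (#-mono ∁b⊆A∖b) ⟩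
        # ((Y ∪ Y₂) ∩ b) + # ((Y ∪ Y₂) ∖ b)  ≡⟨ #-split (Y ∪ Y₂) b ⟨
        # (Y ∪ Y₂)                          ≡⟨ #A≡k ⟩
        k                                   ∎) (trans (cong (_+ # (∁ b)) (sym #b≡k)) (#-∁ b)) 2k+1≤n+t
        where
        open ≤-Reasoning
        ∁b⊆A∖b : ∁ b ⊆ (Y ∪ Y₂) ∖ b
        ∁b⊆A∖b x x∈∁b with Y x in x∈?Y
        ... | true  = x∈∁b
        ... | false = trans (cong (_∧ not (b x)) (∁Y∖b⊆Y₂ x (cong₂ _∧_ (cong not x∈?Y) x∈∁b))) x∈∁b
      few-in-b (inj₁ Y₂∩b≡∅) = subst (_< t) (sym (#-cong only-Y)) (few-in-Y Y-choice)
        where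
        only-Y : (Y ∪ Y₂) ∩ b ≗ Y ∩ b
        only-Y x with Y₂ x in x∈?Y₂
        ... | false = cong (_∧ b x) (∨-identityʳ (Y x))
        ... | true  rewrite Y₂∩b≡∅ x x∈?Y₂ = trans (∧-zeroʳ _) (sym (∧-zeroʳ _))
        few-in-Y : Disjoint Y b ⊎ M ∖ b ⊆ Y → # (Y ∩ b) < t
        few-in-Y (inj₁ Y∩b≡∅) = subst (_< t) (sym (#-empty Y∩b-empty)) 1≤t
          where
          Y∩b-empty : ∀ x → x ∉ Y ∩ b
          Y∩b-empty x with Y x in x∈?Y
          ... | false = refl
          ... | true  = Y∩b≡∅ x x∈?Y
        few-in-Y (inj₂ M∖b⊆Y) = few-inside
          (trans (sym (#-split Y b)) #Y≡t+ℓ)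
          (#-mono λ x x∈M∖b → cong₂ _∧_ (M∖b⊆Y x x∈M∖b) (cong not (proj₂ (∈∖⁻ M b x x∈M∖b))))
          (trans (sym (#-split M b)) (#-segment _ M≤n))
          (subst (_< t + ℓ) (#-∩-comm b M) few-in-M)

allSubsets-complete : ∀ (S : Subset n) → S List.∈ allSubsets n
allSubsets-complete Vec.[]                  = here refl
allSubsets-complete {suc n} (true  Vec.∷ S) = ∈-++⁺ˡ (∈-map⁺ (inside Vec.∷_) (allSubsets-complete S))
allSubsets-complete {suc n} (false Vec.∷ S) = ∈-++⁺ʳ _ (∈-map⁺ (outside Vec.∷_) (allSubsets-complete S))

sum-map-mono : ∀ {A : Set} {f g : A → ℕ} → (∀ x → g x ≤ f x) → ∀ xs → sum (map g xs) ≤ sum (map f xs)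
sum-map-mono g≤f []       = z≤n
sum-map-mono g≤f (x ∷ xs) = +-mono-≤ (g≤f x) (sum-map-mono g≤f xs)

sum-≡⇒pointwise : ∀ {A : Set} {f g : A → ℕ} → (∀ x → g x ≤ f x) →
  ∀ xs → sum (map f xs) ≡ sum (map g xs) → ∀ {x} → x List.∈ xs → f x ≡ g x
sum-≡⇒pointwise g≤f (y ∷ ys) Σ≡ (here refl)   = proj₁ (+-≤-≡ Σ≡ (g≤f y) (sum-map-mono g≤f ys))
sum-≡⇒pointwise g≤f (y ∷ ys) Σ≡ (there x∈ys) =
  sum-≡⇒pointwise g≤f ys (proj₂ (+-≤-≡ Σ≡ (g≤f y) (sum-map-mono g≤f ys))) x∈ys

card-⊆-≡ : ∀ {𝒜 ℬ : Family n} → (∀ S → S ∈ᶠ ℬ → S ∈ᶠ 𝒜) → card 𝒜 ≡ card ℬ → 𝒜 ≐ ℬ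
card-⊆-≡ {n} ℬ⊆𝒜 #𝒜≡#ℬ S =
  ⟦⟧-injective (sum-≡⇒pointwise (λ T → ⟦⟧-mono (ℬ⊆𝒜 T)) (allSubsets n) #𝒜≡#ℬ (allSubsets-complete S))

part-i : ∀ n k t ℓ → ℓ + t ≤ k → 1 ≤ t → 2 * k + 1 ≤ n + t → (ℬ : Family n) → IsKUniform k ℬ →
  CrossInt t (Fam n k t ℓ) ℬ → card (Fam n k t ℓ) ≡ card ℬ → Fam n k t ℓ ≐ ℬ
part-i n k t ℓ ℓ+t≤k 1≤t 2k+1≤n+t ℬ uniform cross #F≡#ℬ = card-⊆-≡ ℬ⊆F #F≡#ℬ
  where
  open FamStructure n k t ℓ
  open Avoidance (proj₁ (outer-size t ℓ ℓ+t≤k)) (proj₂ (outer-size t ℓ ℓ+t≤k)) 1≤t 2k+1≤n+t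
  ℬ⊆F : ∀ S → S ∈ᶠ ℬ → S ∈ᶠ F
  ℬ⊆F S S∈ℬ with true-or-false (F S)
  ... | inj₁ S∈F = S∈F
  ... | inj₂ S∉F with avoider (lookup S) #S≡k (∉F⁻ S S∉F #S≡k)
    where #S≡k = trans (sym (∣∣≡# S)) (uniform S S∈ℬ)
  ...   | A , #A≡k , t+ℓ≤#A∩M , #A∩S<t = ⊥-elim (<⇒≱ #A∩S<t (begin
    t                                   ≤⟨ cross (tabulate A) S A∈F S∈ℬ ⟩
    Subset.∣ tabulate A Subset.∩ S ∣    ≡⟨ ∣∩∣≡# (tabulate A) S ⟩
    # (lookup (tabulate A) ∩ lookup S)  ≡⟨ #-tabulate-∩ A (lookup S) ⟩
    # (A ∩ lookup S)                    ∎))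
    where
    open ≤-Reasoning
    A∈F : tabulate A ∈ᶠ F
    A∈F = ∈F⁺ (tabulate A) (trans (#-cong (lookup∘tabulate A)) #A≡k)
              (subst (t + ℓ ≤_) (sym (#-tabulate-∩ A M)) t+ℓ≤#A∩M)

module CrossShifted (n k t ℓ : ℕ) (ℓ+t≤k : ℓ + t ≤ k) (2≤t : 2 ≤ t) (2k+2≤n+t : 2 * k + 2 ≤ n + t)
                    (𝒜 ℬ : Family n) (cross : CrossInt t 𝒜 ℬ) (i j : Fin n) (i<j : i <ᶠ j)
                    (𝒜↦F : ShiftEq i j 𝒜 (Fam n k t ℓ)) (ℬ↦F : ShiftEq i j ℬ (Fam n k t ℓ)) where

  open FamStructure n k t ℓ
  open Shifting i j
  open ShiftedFamily (F-shifted i j i<j)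

  module OnTightSets (i∈M : i ∈ M) (j∉M : j ∉ M) where
    open TightGraph i j i∈M j∉M (proj₁ (outer-size t ℓ ℓ+t≤k)) (proj₂ (outer-size t ℓ ℓ+t≤k)) 2≤t
                    (two-outer-parts-fit 2 (proj₂ (outer-size t ℓ ℓ+t≤k)) 2k+2≤n+t)

    edge : ∀ {X Y} → Tight i j X → Tight i j Y → # (X ∩ Y) ≤ t → 𝒜 (tabulate X) ≡ ℬ (tabulate Y)
    edge {X} {Y} tight-X tight-Y #X∩Y≤t =
      critical-edge cross 𝒜↦F ℬ↦F (tight⇒critical i j (tabulate X) i∈M j∉M (Tight-tabulate i j tight-X))
                                   (tight⇒critical i j (tabulate Y) i∈M j∉M (Tight-tabulate i j tight-Y))
                    (subst (_≤ t) (sym #-tabulated) #X∩Y≤t)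
      where
      #-tabulated : # (lookup (tabulate X) ∩ lookup (tabulate Y)) ≡ # (X ∩ Y)
      #-tabulated = trans (#-tabulate-∩ X _) (#-cong (λ x → cong (X x ∧_) (lookup∘tabulate Y x)))

    neighbours-agree : ∀ {G H} a b → Tight i j G → Tight i j H → G ⊆ H ∪ ⁅ a ⁆ → H ⊆ G ∪ ⁅ b ⁆ →
      𝒜 (tabulate G) ≡ 𝒜 (tabulate H) × ℬ (tabulate G) ≡ ℬ (tabulate H)
    neighbours-agree {G} {H} a b tight-G tight-H G⊆H∪a H⊆G∪b
      with common-neighbour a b tight-G tight-H G⊆H∪a H⊆G∪b
    ... | K , tight-K , #G∩K≡t , #H∩K≡t =
      trans (edge tight-G tight-K (≤-reflexive #G∩K≡t)) (sym (edge tight-H tight-K (≤-reflexive #H∩K≡t))) ,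
      trans (sym (edge tight-K tight-G (≤-reflexive (trans (#-∩-comm K G) #G∩K≡t))))
            (edge tight-K tight-H (≤-reflexive (trans (#-∩-comm K H) #H∩K≡t)))

    𝒜-constant : ∀ {G H} → Tight i j G → Tight i j H → 𝒜 (tabulate G) ≡ 𝒜 (tabulate H)
    𝒜-constant = tight-connected (𝒜 ∘ tabulate) λ a b tG tH c₁ c₂ → proj₁ (neighbours-agree a b tG tH c₁ c₂)

    ℬ-constant : ∀ {G H} → Tight i j G → Tight i j H → ℬ (tabulate G) ≡ ℬ (tabulate H)
    ℬ-constant = tight-connected (ℬ ∘ tabulate) λ a b tG tH c₁ c₂ → proj₂ (neighbours-agree a b tG tH c₁ c₂)

    𝒜≡ℬ : ∀ {G} → Tight i j G → 𝒜 (tabulate G) ≡ ℬ (tabulate G)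
    𝒜≡ℬ {G} tight-G with common-neighbour i i tight-G tight-G G⊆G∪i G⊆G∪i
      where G⊆G∪i = ⊆⇒⊆∪ ⁅ i ⁆ λ _ x∈G → x∈G
    ... | K , tight-K , #G∩K≡t , _ = trans (edge tight-G tight-K (≤-reflexive #G∩K≡t)) (ℬ-constant tight-K tight-G)

  untabulate : ∀ (𝒳 : Family n) G → 𝒳 (tabulate (lookup G)) ≡ 𝒳 G
  untabulate 𝒳 G = cong 𝒳 (tabulate∘lookup G)

  𝒜≡ℬ-on-critical : ∀ G → Critical F G → 𝒜 G ≡ ℬ G
  𝒜≡ℬ-on-critical G crit with critical⇒tight i j G crit
  ... | tight-G , i∈M , j∉M =
    trans (sym (untabulate 𝒜 G)) (trans (OnTightSets.𝒜≡ℬ i∈M j∉M tight-G) (untabulate ℬ G))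

  𝒜-constant-on-critical : ∀ G H → Critical F G → Critical F H → 𝒜 G ≡ 𝒜 H
  𝒜-constant-on-critical G H crit-G crit-H with critical⇒tight i j G crit-G | critical⇒tight i j H crit-H
  ... | tight-G , i∈M , j∉M | tight-H , _ =
    trans (sym (untabulate 𝒜 G)) (trans (OnTightSets.𝒜-constant i∈M j∉M tight-G tight-H) (untabulate 𝒜 H))

  𝒜≐ℬ : 𝒜 ≐ ℬ
  𝒜≐ℬ = shift-determined 𝒜↦F ℬ↦F 𝒜≡ℬ-on-critical

  𝒜≅F : 𝒜 ≅ᶠ F
  𝒜≅F with anySubset? (λ G → critical? F G ×-dec (𝒜 G ≟ᵇ false))
  ... | yes (G₀ , crit₀ , G₀∉𝒜) = transpose i j , shift-determined 𝒜↦F shift-transposed λ G crit →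
    trans (𝒜-constant-on-critical G G₀ crit crit₀) (trans G₀∉𝒜 (sym (critical-∉-transposed G crit)))
  ... | no none = id , λ S → trans (shift-determined 𝒜↦F shift-fixes all-in S) (cong F (sym (permSet-id S)))
    where
    all-in : ∀ G → Critical F G → 𝒜 G ≡ F G
    all-in G crit with true-or-false (𝒜 G)
    ... | inj₁ G∈𝒜 = trans G∈𝒜 (sym (proj₁ crit))
    ... | inj₂ G∉𝒜 = ⊥-elim (none (G , crit , G∉𝒜))

lemma2p6 : (n k t ℓ : ℕ) → ℓ + t ≤ k → 1 ≤ t → 2 * k + 1 ≤ n + t →
    ((ℬ : Family n) → IsKUniform k ℬ → CrossInt t (Fam n k t ℓ) ℬ →
        card (Fam n k t ℓ) ≡ card ℬ → Fam n k t ℓ ≐ ℬ)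
    × ((𝒜 ℬ : Family n) → 2 ≤ t → 2 * k + 2 ≤ n + t →
        IsKUniform k 𝒜 → IsKUniform k ℬ → CrossInt t 𝒜 ℬ →
        (i j : Fin n) → i <ᶠ j →
        ShiftEq i j 𝒜 (Fam n k t ℓ) → ShiftEq i j ℬ (Fam n k t ℓ) →
        (𝒜 ≐ ℬ) × (𝒜 ≅ᶠ Fam n k t ℓ))
lemma2p6 n k t ℓ ℓ+t≤k 1≤t 2k+1≤n+t =
  part-i n k t ℓ ℓ+t≤k 1≤t 2k+1≤n+t ,
  λ 𝒜 ℬ 2≤t 2k+2≤n+t _ _ cross i j i<j 𝒜↦F ℬ↦F →
    let open CrossShifted n k t ℓ ℓ+t≤k 2≤t 2k+2≤n+t 𝒜 ℬ cross i j i<j 𝒜↦F ℬ↦F in 𝒜≐ℬ , 𝒜≅F
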